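{- In the setting below, let $(A_n)_{n\ge0}$ be the sequence with $A_0=1$ and, for all $n\ge1$, $$\left(1-q^{nN}\right)A_n=\sum_{m=1}^{r}\left(d^{m-1}\sum_{\substack{\alpha<a(r)\\ w(\alpha)=m-1}}q^{\alpha}+d^{m}\sum_{\substack{\alpha<a(r)\\ w(\alpha)=m}}q^{\alpha}+\sum_{j=1}^{r}\sum_{k=0}^{\min(j-1,m-1)}c_{k,j}b_{m-k,j}q^{jN(n-m)}\right)(-1)^{m+1}A_{n-m},$$ and let $(A'_n)_{n\ge0}$ be the sequence with $A'_0=1$ and, for all $n\ge1$, $$\left(1-q^{nN}\right)A'_n=\sum_{m=1}^{r}\left(\sum_{\nu=0}^{r-1}\sum_{\mu=0}^{\min(m-1,\nu)}f_{m,\mu}e_{m,\nu-\mu}q^{\nu N(n-m)}+q^{a(r)}\sum_{\nu=1}^{r}\sum_{\mu=0}^{\min(m-1,\nu-1)}f_{m,\mu}e_{m,\nu-\mu-1}q^{\nu N(n-m)}\right)(-1)^{m+1}A'_{n-m}.$$ Then $A_n=A'_n$ for every $n\ge0$.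
   Context: Let $r\ge1$, let $A=\{a(1),\dots,a(r)\}$ be a set of $r$ distinct integers with $\sum_{i=1}^{k-1}a(i)<a(k)$ for $1\le k\le r$ and with the $2^r-1$ sums of nonempty subsets pairwise distinct; let $A'$ be the set of these sums, $N\ge a(1)+\dots+a(r)$ an integer, and $a(r+1):=N+a(1)$. $d,q$ are fixed with $|d|,|q|<1$. For $\alpha\in A'$, $w(\alpha)$ is the number of elements of $A$ in the unique subset summing to $\alpha$. A sum $\sum_{\alpha<c,\,w(\alpha)=n}q^\alpha$ runs over $\alpha\in A'$ with $\alpha<c$ and $w(\alpha)=n$; it equals $1$ when $n=0$ and $0$ when there is no such $\alpha$. ${m\brack s}_q=\prod_{i=1}^{s}\frac{1-q^{m-s+i}}{1-q^i}$ if $0\le s\le m$, else $0$. Terms with negative index are $0$. Further, $c_{k,j}:=q^{N\frac{k(k+1)}{2}+ka(r)}{j-1\brack k}_{q^N}d^k$, $b_{m,j}:=\left(d^{m-1}\sum_{\alpha<a(r+1),\,w(\alpha)=j+m-1}q^{\alpha}+d^{m}\sum_{\alpha<a(r+1),\,w(\alpha)=j+m}q^{\alpha}\right){j+m-1\brack m-1}_{q^N}$, $e_{m,j}:=\left(d^{m-1}\sum_{\alpha<a(r),\,w(\alpha)=j+m-1}q^{\alpha}+d^{m}\sum_{\alpha<a(r),\,w(\alpha)=j+m}q^{\alpha}\right){j+m-1\brack m-1}_{q^N}$, $f_{m,k}:=q^{N\frac{k(k+1)}{2}+ka(r)}{m-1\brack k}_{q^N}$. -}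

module Defs where

import Level
open import Algebra.Bundles using (CommutativeRing)
open import Data.Nat as ℕ using (ℕ; zero; suc; _∸_; _≤ᵇ_; _<ᵇ_; _≡ᵇ_; _⊓_)
open import Data.Nat.DivMod using (_/_)
open import Data.List using (List; []; _∷_; _++_; map; length; foldr)
open import Data.Bool using (if_then_else_; _∧_)

sumℕ : ℕ → ℕ → (ℕ → ℕ) → ℕ
sumℕ lo hi f = go (suc hi ∸ lo)
  where
  go : ℕ → ℕ
  go zero = 0
  go (suc t) = go t ℕ.+ f (lo ℕ.+ t)

-- all subsets of {1,…,k}, each as a (strictly decreasing) list of indices
subsets : ℕ → List (List ℕ)
subsets zero = [] ∷ []
subsets (suc k) = subsets k ++ map (suc k ∷_) (subsets k)

σ : (ℕ → ℕ) → List ℕ → ℕ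
σ a S = foldr (λ i s → a i ℕ.+ s) 0 S

tri : ℕ → ℕ
tri k = (k ℕ.* suc k) / 2

module Setup {c ℓ} (R : CommutativeRing c ℓ) where
  open CommutativeRing R

  pow : Carrier → ℕ → Carrier
  pow x zero = 1#
  pow x (suc n) = x * pow x n

  Σ[_⋯_] : ℕ → ℕ → (ℕ → Carrier) → Carrier
  Σ[ lo ⋯ hi ] f = go (suc hi ∸ lo)
    where
    go : ℕ → Carrier
    go zero = 0#
    go (suc t) = go t + f (lo ℕ.+ t)

  sign : ℕ → Carrier
  sign m = pow (- 1#) m

  -- Gaussian binomial [m brack s]_Q, via the q-Pascal recurrence
  -- (equals ∏_{i=1}^s (1-Q^{m-s+i})/(1-Q^i) for 0 ≤ s ≤ m, and 0 for s > m)
  qbin : Carrier → ℕ → ℕ → Carrier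
  qbin Q m zero = 1#
  qbin Q zero (suc s) = 0#
  qbin Q (suc m) (suc s) = qbin Q m s + pow Q (suc s) * qbin Q m (suc s)

  -- Σ_{α ∈ A', α < bound, w(α) = n} q^α   (= 1 when n = 0)
  -- Since subset sums are pairwise distinct, summing over α ∈ A' is summing
  -- over the nonempty subsets S ⊆ {1..r} with |S| = n and σ(S) < bound.
  W : Carrier → (ℕ → ℕ) → ℕ → ℕ → ℕ → Carrier
  W q a r bound zero = 1#
  W q a r bound (suc n) =
    foldr (λ S acc → (if (length S ≡ᵇ suc n) ∧ (σ a S <ᵇ bound)
                      then pow q (σ a S) else 0#) + acc)
          0# (subsets r)

  module Coeffs (q d : Carrier) (r N : ℕ) (a : ℕ → ℕ) where
    QN : Carrier
    QN = pow q N

    ar ar1 : ℕ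
    ar = a r
    ar1 = N ℕ.+ a 1

    cc : ℕ → ℕ → Carrier
    cc k j = pow q (N ℕ.* tri k ℕ.+ k ℕ.* ar) * qbin QN (j ∸ 1) k * pow d k

    bb : ℕ → ℕ → Carrier
    bb m j = (pow d (m ∸ 1) * W q a r ar1 (j ℕ.+ m ∸ 1) + pow d m * W q a r ar1 (j ℕ.+ m))
             * qbin QN (j ℕ.+ m ∸ 1) (m ∸ 1)

    ee : ℕ → ℕ → Carrier
    ee m j = (pow d (m ∸ 1) * W q a r ar (j ℕ.+ m ∸ 1) + pow d m * W q a r ar (j ℕ.+ m))
             * qbin QN (j ℕ.+ m ∸ 1) (m ∸ 1)

    ff : ℕ → ℕ → Carrier
    ff m k = pow q (N ℕ.* tri k ℕ.+ k ℕ.* ar) * qbin QN (m ∸ 1) k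

    coef₁ : ℕ → ℕ → Carrier
    coef₁ n m =
      pow d (m ∸ 1) * W q a r ar (m ∸ 1) + pow d m * W q a r ar m
      + Σ[ 1 ⋯ r ] (λ j → Σ[ 0 ⋯ (j ∸ 1) ⊓ (m ∸ 1) ] (λ k →
           cc k j * bb (m ∸ k) j * pow q (j ℕ.* N ℕ.* (n ∸ m))))

    coef₂ : ℕ → ℕ → Carrier
    coef₂ n m =
      Σ[ 0 ⋯ r ∸ 1 ] (λ ν → Σ[ 0 ⋯ (m ∸ 1) ⊓ ν ] (λ μ →
           ff m μ * ee m (ν ∸ μ) * pow q (ν ℕ.* N ℕ.* (n ∸ m))))
      + pow q ar * Σ[ 1 ⋯ r ] (λ ν → Σ[ 0 ⋯ (m ∸ 1) ⊓ (ν ∸ 1) ] (λ μ →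
           ff m μ * ee m (ν ∸ μ ∸ 1) * pow q (ν ℕ.* N ℕ.* (n ∸ m))))

    rhs : (ℕ → ℕ → Carrier) → (ℕ → Carrier) → ℕ → Carrier
    rhs coef X n = Σ[ 1 ⋯ r ] (λ m →
      if m ≤ᵇ n then coef n m * sign (suc m) * X (n ∸ m) else 0#)

  Cancellable : Carrier → Set (c Level.⊔ ℓ)
  Cancellable z = ∀ x y → z * x ≈ z * y → x ≈ y

module Submission where

-- Both recurrences have the leading factor 1 - q^(nN), which is cancellable, so it suffices that
-- their coefficients of (-1)^(m+1) A_(n-m) agree, and we compare them power by power in
-- x_j = q^(jN(n-m)).  Splitting the subsets of {1,…,r} by whether they contain r gives
-- V_(i+1) = U_(i+1) + q^a(r) U_i for the weight sums U below a(r) and V below a(r+1), and U_i = 0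
-- for i ≥ r.  Substituting this into the x_j-coefficient of the first recurrence and summing by
-- parts produces the x_j-coefficient of the second; the terms pair off by a product identity for
-- Gaussian binomials in Q = q^N, proved by clearing q-factorials (the cancellability of 1 - Q^k
-- is used again here).

open import Algebra.Bundles using (CommutativeRing)
open import Data.Bool using (true; false; if_then_else_; _∧_; T)
open import Data.Bool.Properties using (T-≡)
open import Data.Empty using (⊥-elim)
open import Data.Integer using (+_)
open import Data.List using (List; []; _∷_; _++_; map; length; foldr)
open import Data.List.Membership.Propositional using (_∈_)
open import Data.List.Relation.Unary.All as All using (All; []; _∷_)
import Data.List.Relation.Unary.All.Properties as All
open import Data.Nat as ℕ using (ℕ; zero; suc; _≤_; _<_; z≤n; s≤s; _∸_; _⊓_; _<ᵇ_; _≡ᵇ_; _≤ᵇ_)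
open import Data.Nat.DivMod using (/-congˡ; +-distrib-/-∣ʳ; m*n/n≡m)
open import Data.Nat.Divisibility using (divides)
open import Data.Nat.Induction using (<-rec)
import Data.Nat.Properties as ℕ
open import Data.Nat.Tactic.RingSolver using (solve-∀)
open import Data.Product using (_,_)
open import Data.Sum using (inj₁; inj₂)
open import Function.Bundles using (Equivalence)
open import Relation.Binary.Definitions using (tri<; tri≈; tri>)
open import Relation.Binary.PropositionalEquality as ≡ using (_≡_; _≢_)
open import Relation.Nullary using (¬_)
open import Defs

-- Tactic.RingSolver would treat 1# of an abstract ring as an opaque constant and fail on
-- identities such as (1 - x)(1 + x) = 1 - x², so we run Algebra.Solver.Ring with ℤ coefficients.
module ℤ-Coefficients {c ℓ} (R : CommutativeRing c ℓ) where
  open import Algebra.Solver.Ring.AlmostCommutativeRing using (fromCommutativeRing; _-Raw-AlmostCommutative⟶_)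
  import Algebra.Solver.Ring
  open import Data.Integer as ℤ using (ℤ; -[1+_]; _⊖_; _◃_)
  import Data.Integer.Properties as ℤ
  open import Data.Maybe using (Maybe; just; nothing)
  open import Data.Sign as Sign using (Sign)
  open import Relation.Nullary using (yes; no)
  open CommutativeRing R
  open import Algebra.Properties.Ring ring using (-‿distribʳ-*; -1*x≈-x)
  open import Algebra.Properties.AbelianGroup +-abelianGroup using (⁻¹-∙-comm)
  open import Algebra.Properties.Group +-group using (ε⁻¹≈ε; ⁻¹-involutive)
  open import Algebra.Properties.CommutativeSemigroup *-commutativeSemigroup using (interchange)
  open import Algebra.Properties.Semiring.Mult.TCOptimised semiring using (_×_; ×1-homo-*)
  open import Algebra.Properties.Monoid.Mult.TCOptimised +-monoid using (×-homo-+; 1+×)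
  open import Relation.Binary.Reasoning.Setoid setoid

  ⟦_⟧ : ℤ → Carrier
  ⟦ + n ⟧ = n × 1#
  ⟦ -[1+ n ] ⟧ = - (suc n × 1#)

  ⟦_⟧ₛ : Sign → Carrier
  ⟦ Sign.+ ⟧ₛ = 1#
  ⟦ Sign.- ⟧ₛ = - 1#

  ⟦⟧ₛ-homo-* : ∀ s t → ⟦ s Sign.* t ⟧ₛ ≈ ⟦ s ⟧ₛ * ⟦ t ⟧ₛ
  ⟦⟧ₛ-homo-* Sign.+ t = sym (*-identityˡ _)
  ⟦⟧ₛ-homo-* Sign.- Sign.+ = sym (*-identityʳ (- 1#))
  ⟦⟧ₛ-homo-* Sign.- Sign.- = begin
    1# ≈⟨ sym (⁻¹-involutive 1#) ⟩
    - (- 1#) ≈⟨ -‿cong (-1*x≈-x 1#) ⟨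
    - (- 1# * 1#) ≈⟨ -‿distribʳ-* (- 1#) 1# ⟩
    - 1# * - 1# ∎

  ◃-homo : ∀ s n → ⟦ s ◃ n ⟧ ≈ ⟦ s ⟧ₛ * (n × 1#)
  ◃-homo s zero = sym (zeroʳ ⟦ s ⟧ₛ)
  ◃-homo Sign.+ (suc n) = sym (*-identityˡ _)
  ◃-homo Sign.- (suc n) = sym (-1*x≈-x _)

  sign-abs : ∀ i → ⟦ i ⟧ ≈ ⟦ ℤ.sign i ⟧ₛ * (ℤ.∣ i ∣ × 1#)
  sign-abs (+ n) = sym (*-identityˡ _)
  sign-abs -[1+ n ] = sym (-1*x≈-x _)

  *-homo : ∀ i j → ⟦ i ℤ.* j ⟧ ≈ ⟦ i ⟧ * ⟦ j ⟧
  *-homo i j = begin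
    ⟦ (ℤ.sign i Sign.* ℤ.sign j) ◃ (ℤ.∣ i ∣ ℕ.* ℤ.∣ j ∣) ⟧
      ≈⟨ ◃-homo (ℤ.sign i Sign.* ℤ.sign j) (ℤ.∣ i ∣ ℕ.* ℤ.∣ j ∣) ⟩
    ⟦ ℤ.sign i Sign.* ℤ.sign j ⟧ₛ * ((ℤ.∣ i ∣ ℕ.* ℤ.∣ j ∣) × 1#)
      ≈⟨ *-cong (⟦⟧ₛ-homo-* (ℤ.sign i) (ℤ.sign j)) (×1-homo-* ℤ.∣ i ∣ ℤ.∣ j ∣) ⟩
    (⟦ ℤ.sign i ⟧ₛ * ⟦ ℤ.sign j ⟧ₛ) * ((ℤ.∣ i ∣ × 1#) * (ℤ.∣ j ∣ × 1#))
      ≈⟨ interchange _ _ _ _ ⟩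
    (⟦ ℤ.sign i ⟧ₛ * (ℤ.∣ i ∣ × 1#)) * (⟦ ℤ.sign j ⟧ₛ * (ℤ.∣ j ∣ × 1#))
      ≈⟨ *-cong (sign-abs i) (sign-abs j) ⟨
    ⟦ i ⟧ * ⟦ j ⟧ ∎

  -‿homo : ∀ i → ⟦ ℤ.- i ⟧ ≈ - ⟦ i ⟧
  -‿homo -[1+ n ] = sym (⁻¹-involutive _)
  -‿homo (+ zero) = sym ε⁻¹≈ε
  -‿homo (+ suc n) = refl

  ⊖-homo : ∀ m n → ⟦ m ⊖ n ⟧ ≈ (m × 1#) + - (n × 1#)
  ⊖-homo m zero = begin
    ⟦ m ⊖ 0 ⟧ ≡⟨ ≡.cong ⟦_⟧ (ℤ.⊖-≥ {m} {0} ℕ.z≤n) ⟩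
    m × 1# ≈⟨ +-identityʳ _ ⟨
    (m × 1#) + 0# ≈⟨ +-congˡ ε⁻¹≈ε ⟨
    (m × 1#) + - 0# ∎
  ⊖-homo zero (suc n) = sym (+-identityˡ _)
  ⊖-homo (suc m) (suc n) = begin
    ⟦ suc m ⊖ suc n ⟧ ≡⟨ ≡.cong ⟦_⟧ (ℤ.[1+m]⊖[1+n]≡m⊖n m n) ⟩
    ⟦ m ⊖ n ⟧ ≈⟨ ⊖-homo m n ⟩
    M + - N ≈⟨ +-identityˡ _ ⟨
    0# + (M + - N) ≈⟨ +-congʳ (-‿inverseʳ 1#) ⟨
    (1# + - 1#) + (M + - N) ≈⟨ +-assoc 1# (- 1#) _ ⟩
    1# + (- 1# + (M + - N)) ≈⟨ +-congˡ (+-assoc (- 1#) _ _) ⟨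
    1# + ((- 1# + M) + - N) ≈⟨ +-congˡ (+-congʳ (+-comm (- 1#) _)) ⟩
    1# + ((M + - 1#) + - N) ≈⟨ +-congˡ (+-assoc _ _ _) ⟩
    1# + (M + (- 1# + - N)) ≈⟨ +-congˡ (+-congˡ (⁻¹-∙-comm 1# _)) ⟩
    1# + (M + - (1# + N)) ≈⟨ +-assoc _ _ _ ⟨
    (1# + M) + - (1# + N) ≈⟨ +-cong (1+× m 1#) (-‿cong (1+× n 1#)) ⟨
    (suc m × 1#) + - (suc n × 1#) ∎
    where
    M = m × 1#
    N = n × 1#

  +-homo : ∀ i j → ⟦ i ℤ.+ j ⟧ ≈ ⟦ i ⟧ + ⟦ j ⟧
  +-homo (+ m) (+ n) = ×-homo-+ 1# m n
  +-homo (+ m) -[1+ n ] = ⊖-homo m (suc n)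
  +-homo -[1+ m ] (+ n) = trans (⊖-homo n (suc m)) (+-comm _ _)
  +-homo -[1+ m ] -[1+ n ] = begin
    - (suc (suc (m ℕ.+ n)) × 1#) ≈⟨ -‿cong (1+× (suc (m ℕ.+ n)) 1#) ⟩
    - (1# + (suc (m ℕ.+ n) × 1#)) ≈⟨ -‿cong (+-congˡ (×-homo-+ 1# (suc m) n)) ⟩
    - (1# + ((suc m × 1#) + (n × 1#))) ≈⟨ -‿cong (+-assoc _ _ _) ⟨
    - ((1# + (suc m × 1#)) + (n × 1#)) ≈⟨ -‿cong (+-congʳ (+-comm _ _)) ⟩
    - (((suc m × 1#) + 1#) + (n × 1#)) ≈⟨ -‿cong (+-assoc _ _ _) ⟩
    - ((suc m × 1#) + (1# + (n × 1#))) ≈⟨ -‿cong (+-congˡ (1+× n 1#)) ⟨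
    - ((suc m × 1#) + (suc n × 1#)) ≈⟨ ⁻¹-∙-comm _ _ ⟨
    - (suc m × 1#) + - (suc n × 1#) ∎

  homomorphism : ℤ.+-*-rawRing -Raw-AlmostCommutative⟶ fromCommutativeRing R
  homomorphism = record
    { ⟦_⟧ = ⟦_⟧
    ; +-homo = +-homo
    ; *-homo = *-homo
    ; -‿homo = -‿homo
    ; 0-homo = refl
    ; 1-homo = refl
    }

  ≟-homo : ∀ i j → Maybe (⟦ i ⟧ ≈ ⟦ j ⟧)
  ≟-homo i j with i ℤ.≟ j
  ... | yes ≡.refl = just refl
  ... | no _ = nothing

  open Algebra.Solver.Ring ℤ.+-*-rawRing (fromCommutativeRing R) homomorphism ≟-homo public
    using (solve; _:=_; _:+_; _:*_; :-_; _:-_; con)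

a+c+b≡c+[a+b] : ∀ a b c → a ℕ.+ c ℕ.+ b ≡ c ℕ.+ (a ℕ.+ b)
a+c+b≡c+[a+b] = solve-∀

1+[a+b]≡b+[1+a] : ∀ a b → suc (a ℕ.+ b) ≡ b ℕ.+ suc a
1+[a+b]≡b+[1+a] = solve-∀

2+[a+b]≡[1+b]+[1+a] : ∀ a b → suc (suc (a ℕ.+ b)) ≡ suc b ℕ.+ suc a
2+[a+b]≡[1+b]+[1+a] = solve-∀

1+[a+b+c]≡a+c+[1+b] : ∀ a b c → suc (a ℕ.+ b ℕ.+ c) ≡ a ℕ.+ c ℕ.+ suc b
1+[a+b+c]≡a+c+[1+b] = solve-∀

a+[b+c]≡b+[a+c] : ∀ a b c → a ℕ.+ (b ℕ.+ c) ≡ b ℕ.+ (a ℕ.+ c)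
a+[b+c]≡b+[a+c] = solve-∀

J+[1+t+w]≡t+[1+J+w] : ∀ J t w → J ℕ.+ (suc t ℕ.+ w) ≡ t ℕ.+ suc (J ℕ.+ w)
J+[1+t+w]≡t+[1+J+w] = solve-∀

<⇒<ᵇ≡true : ∀ {m n} → m < n → (m <ᵇ n) ≡ true
<⇒<ᵇ≡true m<n = Equivalence.to T-≡ (ℕ.<⇒<ᵇ m<n)

≮⇒<ᵇ≡false : ∀ {m n} → ¬ (m < n) → (m <ᵇ n) ≡ false
≮⇒<ᵇ≡false {m} {n} m≮n with m <ᵇ n in eq
... | false = ≡.refl
... | true = ⊥-elim (m≮n (ℕ.<ᵇ⇒< m n (≡.subst T (≡.sym eq) _)))

if-∧-true : ∀ {a} {A : Set a} b {c} (x y : A) → c ≡ true → (if b ∧ c then x else y) ≡ (if b then x else y)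
if-∧-true true x y ≡.refl = ≡.refl
if-∧-true false x y _ = ≡.refl

if-∧-false : ∀ {a} {A : Set a} b {c} (x y : A) → c ≡ false → (if b ∧ c then x else y) ≡ y
if-∧-false true x y ≡.refl = ≡.refl
if-∧-false false x y _ = ≡.refl

σ-subsets-≤ : ∀ a k → All (λ S → σ a S ≤ sumℕ 1 k a) (subsets k)
σ-subsets-≤ a zero = z≤n ∷ []
σ-subsets-≤ a (suc k) = All.++⁺
  (All.map (λ σ≤ → ℕ.≤-trans σ≤ (ℕ.m≤m+n _ _)) (σ-subsets-≤ a k))
  (All.map⁺ (All.map (λ σ≤ → ℕ.≤-trans (ℕ.+-monoʳ-≤ (a (suc k)) σ≤) (ℕ.≤-reflexive (ℕ.+-comm (a (suc k)) _))) (σ-subsets-≤ a k)))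

J+M∸μ<M : ∀ J M μ → J < μ → μ ≤ M → J ℕ.+ M ∸ μ < M
J+M∸μ<M J M μ J<μ μ≤M = ≡.subst (J ℕ.+ M ∸ μ <_) (ℕ.m+n∸m≡n μ M)
  (ℕ.∸-monoˡ-< (ℕ.+-monoˡ-< M J<μ) (ℕ.≤-trans μ≤M (ℕ.m≤n+m M J)))

tri-suc : ∀ t → tri (suc t) ≡ tri t ℕ.+ suc t
tri-suc t = ≡.trans (/-congˡ (expand t)) (≡.trans (+-distrib-/-∣ʳ (t ℕ.* suc t) (divides (suc t) ≡.refl)) (≡.cong (tri t ℕ.+_) (m*n/n≡m (suc t) 2)))
  where
  expand : ∀ t → suc t ℕ.* suc (suc t) ≡ t ℕ.* suc t ℕ.+ suc t ℕ.* 2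
  expand = solve-∀

g-exponent-suc : ∀ N T t ar → N ℕ.* (T ℕ.+ suc t) ℕ.+ suc t ℕ.* ar ≡ suc t ℕ.* N ℕ.+ (ar ℕ.+ (N ℕ.* T ℕ.+ t ℕ.* ar))
g-exponent-suc = solve-∀

module _ {c ℓ} (R : CommutativeRing c ℓ) where
  open CommutativeRing R hiding (zero)
  open Setup R
  open ℤ-Coefficients R using (solve; _:=_; _:+_; _:*_; :-_; _:-_; con)
  open import Relation.Binary.Reasoning.Setoid setoid

  pow-+ : ∀ x m n → pow x (m ℕ.+ n) ≈ pow x m * pow x n
  pow-+ x zero n = sym (*-identityˡ _)
  pow-+ x (suc m) n = trans (*-congˡ (pow-+ x m n)) (sym (*-assoc _ _ _))

  pow-* : ∀ x m n → pow (pow x m) n ≈ pow x (n ℕ.* m)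
  pow-* x m zero = refl
  pow-* x m (suc n) = trans (*-congˡ (pow-* x m n)) (sym (pow-+ x m (n ℕ.* m)))

  Cancellable-resp : ∀ {z z′} → z ≈ z′ → Cancellable z → Cancellable z′
  Cancellable-resp z≈z′ cz x y eq = cz x y (trans (*-congʳ z≈z′) (trans eq (*-congʳ (sym z≈z′))))

  1-cancellable : Cancellable 1#
  1-cancellable x y eq = trans (sym (*-identityˡ x)) (trans eq (*-identityˡ y))

  *-cancellable : ∀ {y z} → Cancellable y → Cancellable z → Cancellable (y * z)
  *-cancellable cy cz u v eq = cz u v (cy _ _ (trans (sym (*-assoc _ _ _)) (trans eq (*-assoc _ _ _))))

  x≈0⇒x*y≈0 : ∀ {x} y → x ≈ 0# → x * y ≈ 0#
  x≈0⇒x*y≈0 y x≈0 = trans (*-congʳ x≈0) (zeroˡ y)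

  [1-p]x≈[1-n]z : ∀ x z p n → x + n * z ≈ p * x + z → (1# + - p) * x ≈ (1# + - n) * z
  [1-p]x≈[1-n]z x z p n eq = begin
    (1# + - p) * x
      ≈⟨ solve 4 (λ x z p n → (con (+ 1) :- p) :* x := (x :+ n :* z) :+ (:- (p :* x :+ z)) :+ (con (+ 1) :- n) :* z) refl x z p n ⟩
    (x + n * z) + - (p * x + z) + (1# + - n) * z
      ≈⟨ +-congʳ (+-congʳ eq) ⟩
    (p * x + z) + - (p * x + z) + (1# + - n) * z
      ≈⟨ solve 3 (λ y z n → y :+ (:- y) :+ (con (+ 1) :- n) :* z := (con (+ 1) :- n) :* z) refl (p * x + z) z n ⟩
    (1# + - n) * z ∎

  Σ₀-cong : ∀ h {f g} → (∀ i → i ≤ h → f i ≈ g i) → Σ[ 0 ⋯ h ] f ≈ Σ[ 0 ⋯ h ] g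
  Σ₀-cong zero f≈g = +-congˡ (f≈g 0 z≤n)
  Σ₀-cong (suc h) f≈g = +-cong (Σ₀-cong h (λ i i≤h → f≈g i (ℕ.m≤n⇒m≤1+n i≤h))) (f≈g (suc h) ℕ.≤-refl)

  Σ₁-cong : ∀ h {f g} → (∀ i → 1 ≤ i → i ≤ h → f i ≈ g i) → Σ[ 1 ⋯ h ] f ≈ Σ[ 1 ⋯ h ] g
  Σ₁-cong zero f≈g = refl
  Σ₁-cong (suc h) f≈g = +-cong (Σ₁-cong h (λ i 1≤i i≤h → f≈g i 1≤i (ℕ.m≤n⇒m≤1+n i≤h))) (f≈g (suc h) (s≤s z≤n) ℕ.≤-refl)

  Σ₀≈f0+Σ₁ : ∀ h f → Σ[ 0 ⋯ h ] f ≈ f 0 + Σ[ 1 ⋯ h ] f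
  Σ₀≈f0+Σ₁ zero f = +-comm _ _
  Σ₀≈f0+Σ₁ (suc h) f = trans (+-congʳ (Σ₀≈f0+Σ₁ h f)) (+-assoc _ _ _)

  Σ₀-zero : ∀ h → Σ[ 0 ⋯ h ] (λ _ → 0#) ≈ 0#
  Σ₀-zero zero = +-identityˡ 0#
  Σ₀-zero (suc h) = trans (+-congʳ (Σ₀-zero h)) (+-identityˡ 0#)

  Σ₀-+ : ∀ h f g → Σ[ 0 ⋯ h ] f + Σ[ 0 ⋯ h ] g ≈ Σ[ 0 ⋯ h ] (λ i → f i + g i)
  Σ₀-+ zero f g = solve 2 (λ x y → (con (+ 0) :+ x) :+ (con (+ 0) :+ y) := con (+ 0) :+ (x :+ y)) refl (f 0) (g 0)
  Σ₀-+ (suc h) f g = trans (solve 4 (λ x y z w → (x :+ y) :+ (z :+ w) := (x :+ z) :+ (y :+ w)) refl _ _ _ _) (+-congʳ (Σ₀-+ h f g))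

  Σ₁-+ : ∀ h f g → Σ[ 1 ⋯ h ] f + Σ[ 1 ⋯ h ] g ≈ Σ[ 1 ⋯ h ] (λ i → f i + g i)
  Σ₁-+ zero f g = +-identityˡ _
  Σ₁-+ (suc h) f g = trans (solve 4 (λ x y z w → (x :+ y) :+ (z :+ w) := (x :+ z) :+ (y :+ w)) refl _ _ _ _) (+-congʳ (Σ₁-+ h f g))

  Σ₀-*ˡ : ∀ h x f → x * Σ[ 0 ⋯ h ] f ≈ Σ[ 0 ⋯ h ] (λ i → x * f i)
  Σ₀-*ˡ zero x f = trans (distribˡ _ _ _) (+-congʳ (zeroʳ x))
  Σ₀-*ˡ (suc h) x f = trans (distribˡ _ _ _) (+-congʳ (Σ₀-*ˡ h x f))

  Σ₁-*ˡ : ∀ h x f → x * Σ[ 1 ⋯ h ] f ≈ Σ[ 1 ⋯ h ] (λ i → x * f i)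
  Σ₁-*ˡ zero x f = zeroʳ x
  Σ₁-*ˡ (suc h) x f = trans (distribˡ _ _ _) (+-congʳ (Σ₁-*ˡ h x f))

  Σ₀-*ʳ : ∀ h x f → Σ[ 0 ⋯ h ] f * x ≈ Σ[ 0 ⋯ h ] (λ i → f i * x)
  Σ₀-*ʳ h x f = trans (*-comm _ _) (trans (Σ₀-*ˡ h x f) (Σ₀-cong h (λ i _ → *-comm _ _)))

  Σ₀-linear : ∀ h (w u v : ℕ → Carrier) x y →
    Σ[ 0 ⋯ h ] (λ i → w i * (x * u i + y * v i)) ≈ x * Σ[ 0 ⋯ h ] (λ i → w i * u i) + y * Σ[ 0 ⋯ h ] (λ i → w i * v i)
  Σ₀-linear h w u v x y = begin
    Σ[ 0 ⋯ h ] (λ i → w i * (x * u i + y * v i))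
      ≈⟨ Σ₀-cong h (λ i _ → solve 5 (λ w u v x y → w :* (x :* u :+ y :* v) := x :* (w :* u) :+ y :* (w :* v)) refl (w i) (u i) (v i) x y) ⟩
    Σ[ 0 ⋯ h ] (λ i → x * (w i * u i) + y * (w i * v i))
      ≈⟨ Σ₀-+ h _ _ ⟨
    Σ[ 0 ⋯ h ] (λ i → x * (w i * u i)) + Σ[ 0 ⋯ h ] (λ i → y * (w i * v i))
      ≈⟨ +-cong (Σ₀-*ˡ h x _) (Σ₀-*ˡ h y _) ⟨
    x * Σ[ 0 ⋯ h ] (λ i → w i * u i) + y * Σ[ 0 ⋯ h ] (λ i → w i * v i) ∎

  Σ₀-extend : ∀ h h′ f → h ≤ h′ → (∀ i → h < i → i ≤ h′ → f i ≈ 0#) → Σ[ 0 ⋯ h ] f ≈ Σ[ 0 ⋯ h′ ] f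
  Σ₀-extend h h′ f h≤h′ tail≈0 with ℕ.m≤n⇒m<n∨m≡n h≤h′
  ... | inj₂ ≡.refl = refl
  Σ₀-extend h (suc h′) f _ tail≈0 | inj₁ (s≤s h≤h′) = begin
    Σ[ 0 ⋯ h ] f ≈⟨ Σ₀-extend h h′ f h≤h′ (λ i h<i i≤h′ → tail≈0 i h<i (ℕ.m≤n⇒m≤1+n i≤h′)) ⟩
    Σ[ 0 ⋯ h′ ] f ≈⟨ +-identityʳ _ ⟨
    Σ[ 0 ⋯ h′ ] f + 0# ≈⟨ +-congˡ (tail≈0 (suc h′) (s≤s h≤h′) ℕ.≤-refl) ⟨
    Σ[ 0 ⋯ h′ ] f + f (suc h′) ∎

  Σ₀-⊓ : ∀ L M f g → (∀ i → i ≤ L → i ≤ M → f i ≈ g i) → (∀ i → L < i → i ≤ M → g i ≈ 0#) →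
    Σ[ 0 ⋯ L ⊓ M ] f ≈ Σ[ 0 ⋯ M ] g
  Σ₀-⊓ L M f g f≈g tail≈0 = trans
    (Σ₀-cong (L ⊓ M) (λ i i≤ → f≈g i (ℕ.≤-trans i≤ (ℕ.m⊓n≤m L M)) (ℕ.≤-trans i≤ (ℕ.m⊓n≤n L M))))
    (Σ₀-extend (L ⊓ M) M g (ℕ.m⊓n≤n L M) (λ i L⊓M<i i≤M → tail≈0 i (L<i L⊓M<i i≤M) i≤M))
    where
    L<i : ∀ {i} → L ⊓ M < i → i ≤ M → L < i
    L<i {i} L⊓M<i i≤M = ℕ.≰⇒> (λ i≤L → ℕ.<⇒≱ L⊓M<i (ℕ.⊓-glb i≤L i≤M))

  -- Abel summation: the f-terms at t+1 pair off with the h-terms at t.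
  Σ₀-shift : ∀ M f h f′ h′ → f 0 ≈ f′ 0 → h M ≈ h′ M → (∀ t → suc t ≤ M → f (suc t) + h t ≈ f′ (suc t) + h′ t) →
    Σ[ 0 ⋯ M ] f + Σ[ 0 ⋯ M ] h ≈ Σ[ 0 ⋯ M ] f′ + Σ[ 0 ⋯ M ] h′
  Σ₀-shift M f h f′ h′ f0≈ hM≈ step≈ = begin
    Σ[ 0 ⋯ M ] f + Σ[ 0 ⋯ M ] h ≈⟨ partial M ℕ.≤-refl ⟩
    (Σ[ 0 ⋯ M ] f′ + Σ[ 0 ⋯ M ] h′) + (h M + - h′ M) ≈⟨ +-congˡ (+-congʳ hM≈) ⟩
    (Σ[ 0 ⋯ M ] f′ + Σ[ 0 ⋯ M ] h′) + (h′ M + - h′ M) ≈⟨ solve 2 (λ x y → x :+ (y :- y) := x) refl _ (h′ M) ⟩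
    Σ[ 0 ⋯ M ] f′ + Σ[ 0 ⋯ M ] h′ ∎
    where
    partial : ∀ K → K ≤ M → Σ[ 0 ⋯ K ] f + Σ[ 0 ⋯ K ] h ≈ (Σ[ 0 ⋯ K ] f′ + Σ[ 0 ⋯ K ] h′) + (h K + - h′ K)
    partial zero _ = begin
      (0# + f 0) + (0# + h 0) ≈⟨ +-congʳ (+-congˡ f0≈) ⟩
      (0# + f′ 0) + (0# + h 0)
        ≈⟨ solve 3 (λ x y z → (con (+ 0) :+ x) :+ (con (+ 0) :+ y) := ((con (+ 0) :+ x) :+ (con (+ 0) :+ z)) :+ (y :- z)) refl (f′ 0) (h 0) (h′ 0) ⟩
      (0# + f′ 0) + (0# + h′ 0) + (h 0 + - h′ 0) ∎
    partial (suc K) K<M = begin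
      (SF + f (suc K)) + (SH + h (suc K))
        ≈⟨ solve 4 (λ x y z w → (x :+ y) :+ (z :+ w) := (x :+ z) :+ y :+ w) refl SF (f (suc K)) SH (h (suc K)) ⟩
      (SF + SH) + f (suc K) + h (suc K)
        ≈⟨ +-congʳ (+-congʳ (partial K (ℕ.<⇒≤ K<M))) ⟩
      ((SF′ + SH′) + (h K + - h′ K)) + f (suc K) + h (suc K)
        ≈⟨ solve 6 (λ x y z w u v → ((x :+ y) :+ (z :- w)) :+ u :+ v := (x :+ y) :+ (u :+ z) :- w :+ v) refl SF′ SH′ (h K) (h′ K) (f (suc K)) (h (suc K)) ⟩
      (SF′ + SH′) + (f (suc K) + h K) + - h′ K + h (suc K)
        ≈⟨ +-congʳ (+-congʳ (+-congˡ (step≈ K K<M))) ⟩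
      (SF′ + SH′) + (f′ (suc K) + h′ K) + - h′ K + h (suc K)
        ≈⟨ solve 6 (λ x y u w v z → (x :+ y) :+ (u :+ w) :- w :+ v := (x :+ u) :+ (y :+ z) :+ (v :- z)) refl SF′ SH′ (f′ (suc K)) (h′ K) (h (suc K)) (h′ (suc K)) ⟩
      (SF′ + f′ (suc K)) + (SH′ + h′ (suc K)) + (h (suc K) + - h′ (suc K)) ∎
      where
      SF = Σ[ 0 ⋯ K ] f
      SH = Σ[ 0 ⋯ K ] h
      SF′ = Σ[ 0 ⋯ K ] f′
      SH′ = Σ[ 0 ⋯ K ] h′

  module GaussianBinomial (Q : Carrier) where

    qbin-≡ : ∀ {n n′} k → n ≡ n′ → qbin Q n k ≈ qbin Q n′ k
    qbin-≡ k ≡.refl = refl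

    qbin-< : ∀ n k → n < k → qbin Q n k ≈ 0#
    qbin-< zero (suc k) _ = refl
    qbin-< (suc n) (suc k) (s≤s n<k) = begin
      qbin Q n k + pow Q (suc k) * qbin Q n (suc k) ≈⟨ +-cong (qbin-< n k n<k) (*-congˡ (qbin-< n (suc k) (ℕ.m<n⇒m<1+n n<k))) ⟩
      0# + pow Q (suc k) * 0# ≈⟨ +-identityˡ _ ⟩
      pow Q (suc k) * 0# ≈⟨ zeroʳ _ ⟩
      0# ∎

    qbin-diag : ∀ n → qbin Q n n ≈ 1#
    qbin-diag zero = refl
    qbin-diag (suc n) = begin
      qbin Q n n + pow Q (suc n) * qbin Q n (suc n) ≈⟨ +-cong (qbin-diag n) (*-congˡ (qbin-< n (suc n) (ℕ.n<1+n n))) ⟩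
      1# + pow Q (suc n) * 0# ≈⟨ +-congˡ (zeroʳ _) ⟩
      1# + 0# ≈⟨ +-identityʳ _ ⟩
      1# ∎

    -- [a+b choose a], the form in which the Gaussian binomial is symmetric in a and b.
    qbin₂ : ℕ → ℕ → Carrier
    qbin₂ a b = qbin Q (a ℕ.+ b) a

    qbin₂-zeroʳ : ∀ a → qbin₂ a 0 ≈ 1#
    qbin₂-zeroʳ a = trans (qbin-≡ a (ℕ.+-identityʳ a)) (qbin-diag a)

    qbin₂-pascal : ∀ a b → qbin₂ (suc a) (suc b) ≈ qbin₂ a (suc b) + pow Q (suc a) * qbin₂ (suc a) b
    qbin₂-pascal a b = +-congˡ (*-congˡ (qbin-≡ (suc a) (ℕ.+-suc a b)))

    qbin₂-pascal-swap : ∀ a b →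
      qbin₂ a (suc b) + pow Q (suc a) * qbin₂ (suc a) b ≈ pow Q (suc b) * qbin₂ a (suc b) + qbin₂ (suc a) b
    qbin₂-pascal-swap zero zero = begin
      1# + pow Q 1 * qbin₂ 1 0 ≈⟨ +-congˡ (*-congˡ (qbin₂-zeroʳ 1)) ⟩
      1# + pow Q 1 * 1# ≈⟨ +-comm _ _ ⟩
      pow Q 1 * 1# + 1# ≈⟨ +-congˡ (qbin₂-zeroʳ 1) ⟨
      pow Q 1 * 1# + qbin₂ 1 0 ∎
    qbin₂-pascal-swap zero (suc b) = begin
      1# + pow Q 1 * qbin₂ 1 (suc b) ≈⟨ +-congˡ (*-congˡ (qbin₂-pascal 0 b)) ⟩
      1# + pow Q 1 * (1# + pow Q 1 * qbin₂ 1 b) ≈⟨ +-congˡ (*-congˡ (qbin₂-pascal-swap zero b)) ⟩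
      1# + pow Q 1 * (pow Q (suc b) * 1# + qbin₂ 1 b)
        ≈⟨ solve 3 (λ q P X → con (+ 1) :+ (q :* con (+ 1)) :* (P :* con (+ 1) :+ X) := (q :* P) :* con (+ 1) :+ (con (+ 1) :+ (q :* con (+ 1)) :* X)) refl Q (pow Q (suc b)) (qbin₂ 1 b) ⟩
      pow Q (suc (suc b)) * 1# + (1# + pow Q 1 * qbin₂ 1 b) ≈⟨ +-congˡ (qbin₂-pascal 0 b) ⟨
      pow Q (suc (suc b)) * 1# + qbin₂ 1 (suc b) ∎
    qbin₂-pascal-swap (suc a) zero = begin
      qbin₂ (suc a) 1 + pow Q (suc (suc a)) * qbin₂ (suc (suc a)) 0
        ≈⟨ +-cong (trans (qbin₂-pascal a 0) (qbin₂-pascal-swap a zero)) (*-congˡ (qbin₂-zeroʳ (suc (suc a)))) ⟩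
      (pow Q 1 * qbin₂ a 1 + qbin₂ (suc a) 0) + pow Q (suc (suc a)) * 1#
        ≈⟨ +-congʳ (+-congˡ (qbin₂-zeroʳ (suc a))) ⟩
      (pow Q 1 * qbin₂ a 1 + 1#) + (Q * pow Q (suc a)) * 1#
        ≈⟨ solve 3 (λ q Y P → ((q :* con (+ 1)) :* Y :+ con (+ 1)) :+ (q :* P) :* con (+ 1) := (q :* con (+ 1)) :* (Y :+ P :* con (+ 1)) :+ con (+ 1)) refl Q (qbin₂ a 1) (pow Q (suc a)) ⟩
      pow Q 1 * (qbin₂ a 1 + pow Q (suc a) * 1#) + 1#
        ≈⟨ +-cong (*-congˡ (trans (qbin₂-pascal a 0) (+-congˡ (*-congˡ (qbin₂-zeroʳ (suc a)))))) (qbin₂-zeroʳ (suc (suc a))) ⟨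
      pow Q 1 * qbin₂ (suc a) 1 + qbin₂ (suc (suc a)) 0 ∎
    qbin₂-pascal-swap (suc a) (suc b) = begin
      qbin₂ (suc a) (suc (suc b)) + pow Q (suc (suc a)) * qbin₂ (suc (suc a)) (suc b)
        ≈⟨ +-cong (qbin₂-pascal a (suc b)) (*-congˡ (qbin₂-pascal (suc a) b)) ⟩
      (X + Pa * Y) + (Q * Pa) * (Y + (Q * Pa) * Z)
        ≈⟨ +-cong (qbin₂-pascal-swap a (suc b)) (*-congˡ (qbin₂-pascal-swap (suc a) b)) ⟩
      ((Q * Pb) * X + Y) + (Q * Pa) * (Pb * Y + Z)
        ≈⟨ solve 6 (λ q pa pb x y z → ((q :* pb) :* x :+ y) :+ (q :* pa) :* (pb :* y :+ z) := (q :* pb) :* (x :+ pa :* y) :+ (y :+ (q :* pa) :* z)) refl Q Pa Pb X Y Z ⟩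
      (Q * Pb) * (X + Pa * Y) + (Y + (Q * Pa) * Z)
        ≈⟨ +-cong (*-congˡ (qbin₂-pascal a (suc b))) (qbin₂-pascal (suc a) b) ⟨
      pow Q (suc (suc b)) * qbin₂ (suc a) (suc (suc b)) + qbin₂ (suc (suc a)) (suc b) ∎
      where
      X = qbin₂ a (suc (suc b))
      Y = qbin₂ (suc a) (suc b)
      Z = qbin₂ (suc (suc a)) b
      Pa = pow Q (suc a)
      Pb = pow Q (suc b)

    qbin₂-pascal′ : ∀ a b → qbin₂ (suc a) (suc b) ≈ pow Q (suc b) * qbin₂ a (suc b) + qbin₂ (suc a) b
    qbin₂-pascal′ a b = trans (qbin₂-pascal a b) (qbin₂-pascal-swap a b)

    qbin₂-sym : ∀ a b → qbin₂ a b ≈ qbin₂ b a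
    qbin₂-sym zero zero = refl
    qbin₂-sym zero (suc b) = sym (qbin₂-zeroʳ (suc b))
    qbin₂-sym (suc a) zero = qbin₂-zeroʳ (suc a)
    qbin₂-sym (suc a) (suc b) = begin
      qbin₂ (suc a) (suc b) ≈⟨ qbin₂-pascal a b ⟩
      qbin₂ a (suc b) + pow Q (suc a) * qbin₂ (suc a) b ≈⟨ +-cong (qbin₂-sym a (suc b)) (*-congˡ (qbin₂-sym (suc a) b)) ⟩
      qbin₂ (suc b) a + pow Q (suc a) * qbin₂ b (suc a) ≈⟨ +-comm _ _ ⟩
      pow Q (suc a) * qbin₂ b (suc a) + qbin₂ (suc b) a ≈⟨ qbin₂-pascal′ b a ⟨
      qbin₂ (suc b) (suc a) ∎

    1-Q^_ : ℕ → Carrier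
    1-Q^ k = 1# + - pow Q k

    qbin₂-absorbʳ : ∀ a b → (1-Q^ suc b) * qbin₂ a (suc b) ≈ (1-Q^ suc (a ℕ.+ b)) * qbin₂ a b
    qbin₂-absorbʳ a b = [1-p]x≈[1-n]z _ _ _ _ (both-pascals a b)
      where
      both-pascals : ∀ a b → qbin₂ a (suc b) + pow Q (suc (a ℕ.+ b)) * qbin₂ a b ≈ pow Q (suc b) * qbin₂ a (suc b) + qbin₂ a b
      both-pascals zero b = +-comm _ _
      both-pascals (suc a) b = begin
        X + pow Q (suc (suc a ℕ.+ b)) * Z
          ≈⟨ +-congˡ (*-congʳ (trans (reflexive (≡.cong (pow Q) (≡.sym (ℕ.+-suc (suc a) b)))) (pow-+ Q (suc a) (suc b)))) ⟩
        X + (Pa * Pb) * Z ≈⟨ +-congʳ (qbin₂-pascal′ a b) ⟩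
        (Pb * Y + Z) + (Pa * Pb) * Z ≈⟨ solve 4 (λ pa pb y z → (pb :* y :+ z) :+ (pa :* pb) :* z := pb :* (y :+ pa :* z) :+ z) refl Pa Pb Y Z ⟩
        Pb * (Y + Pa * Z) + Z ≈⟨ +-congʳ (*-congˡ (qbin₂-pascal a b)) ⟨
        Pb * X + Z ∎
        where
        X = qbin₂ (suc a) (suc b)
        Y = qbin₂ a (suc b)
        Z = qbin₂ (suc a) b
        Pa = pow Q (suc a)
        Pb = pow Q (suc b)

    qbin₂-absorbˡ : ∀ a b → (1-Q^ suc a) * qbin₂ (suc a) b ≈ (1-Q^ suc (a ℕ.+ b)) * qbin₂ a b
    qbin₂-absorbˡ a b = begin
      (1-Q^ suc a) * qbin₂ (suc a) b ≈⟨ *-congˡ (qbin₂-sym (suc a) b) ⟩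
      (1-Q^ suc a) * qbin₂ b (suc a) ≈⟨ qbin₂-absorbʳ b a ⟩
      (1-Q^ suc (b ℕ.+ a)) * qbin₂ b a ≈⟨ *-cong (reflexive (≡.cong (λ n → 1-Q^ suc n) (ℕ.+-comm b a))) (qbin₂-sym b a) ⟩
      (1-Q^ suc (a ℕ.+ b)) * qbin₂ a b ∎

    [_]! : ℕ → Carrier
    [ zero ]! = 1#
    [ suc k ]! = (1-Q^ suc k) * [ k ]!

    []!*[]!*qbin₂≈[]! : ∀ a b → [ a ]! * [ b ]! * qbin₂ a b ≈ [ a ℕ.+ b ]!
    []!*[]!*qbin₂≈[]! a zero = begin
      [ a ]! * 1# * qbin₂ a 0 ≈⟨ *-cong (*-identityʳ _) (qbin₂-zeroʳ a) ⟩
      [ a ]! * 1# ≈⟨ *-identityʳ _ ⟩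
      [ a ]! ≡⟨ ≡.cong [_]! (ℕ.+-identityʳ a) ⟨
      [ a ℕ.+ 0 ]! ∎
    []!*[]!*qbin₂≈[]! a (suc b) = begin
      [ a ]! * ((1-Q^ suc b) * [ b ]!) * qbin₂ a (suc b)
        ≈⟨ solve 4 (λ fa x fb t → fa :* (x :* fb) :* t := (fa :* fb) :* (x :* t)) refl [ a ]! (1-Q^ suc b) [ b ]! (qbin₂ a (suc b)) ⟩
      ([ a ]! * [ b ]!) * ((1-Q^ suc b) * qbin₂ a (suc b)) ≈⟨ *-congˡ (qbin₂-absorbʳ a b) ⟩
      ([ a ]! * [ b ]!) * ((1-Q^ suc (a ℕ.+ b)) * qbin₂ a b)
        ≈⟨ solve 4 (λ fa x fb t → (fa :* fb) :* (x :* t) := x :* (fa :* fb :* t)) refl [ a ]! (1-Q^ suc (a ℕ.+ b)) [ b ]! (qbin₂ a b) ⟩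
      (1-Q^ suc (a ℕ.+ b)) * ([ a ]! * [ b ]! * qbin₂ a b) ≈⟨ *-congˡ ([]!*[]!*qbin₂≈[]! a b) ⟩
      [ suc (a ℕ.+ b) ]! ≡⟨ ≡.cong [_]! (ℕ.+-suc a b) ⟨
      [ a ℕ.+ suc b ]! ∎

    module Cancellative (1-Q^-cancellable : ∀ k → Cancellable (1-Q^ suc k)) where

      []!-cancellable : ∀ k → Cancellable [ k ]!
      []!-cancellable zero = 1-cancellable
      []!-cancellable (suc k) = *-cancellable (1-Q^-cancellable k) ([]!-cancellable k)

      -- both sides are the q-multinomial [a+b+c; a,b,c], as one sees after multiplying by [a]![b]![c]!
      qbin₂-trinomial : ∀ a b c → qbin₂ (a ℕ.+ c) b * qbin₂ a c ≈ qbin₂ a b * qbin₂ c (a ℕ.+ b)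
      qbin₂-trinomial a b c = cancel _ _ (begin
        K * (qbin₂ (a ℕ.+ c) b * qbin₂ a c)
          ≈⟨ solve 5 (λ fa fb fc x y → fa :* fb :* fc :* (x :* y) := fb :* (fa :* fc :* y) :* x) refl [ a ]! [ b ]! [ c ]! (qbin₂ (a ℕ.+ c) b) (qbin₂ a c) ⟩
        [ b ]! * ([ a ]! * [ c ]! * qbin₂ a c) * qbin₂ (a ℕ.+ c) b ≈⟨ *-congʳ (*-congˡ ([]!*[]!*qbin₂≈[]! a c)) ⟩
        [ b ]! * [ a ℕ.+ c ]! * qbin₂ (a ℕ.+ c) b ≈⟨ *-congʳ (*-comm _ _) ⟩
        [ a ℕ.+ c ]! * [ b ]! * qbin₂ (a ℕ.+ c) b ≈⟨ []!*[]!*qbin₂≈[]! (a ℕ.+ c) b ⟩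
        [ a ℕ.+ c ℕ.+ b ]! ≡⟨ ≡.cong [_]! (a+c+b≡c+[a+b] a b c) ⟩
        [ c ℕ.+ (a ℕ.+ b) ]! ≈⟨ []!*[]!*qbin₂≈[]! c (a ℕ.+ b) ⟨
        [ c ]! * [ a ℕ.+ b ]! * qbin₂ c (a ℕ.+ b) ≈⟨ *-congʳ (*-congˡ ([]!*[]!*qbin₂≈[]! a b)) ⟨
        [ c ]! * ([ a ]! * [ b ]! * qbin₂ a b) * qbin₂ c (a ℕ.+ b)
          ≈⟨ solve 5 (λ fa fb fc x y → fc :* (fa :* fb :* x) :* y := fa :* fb :* fc :* (x :* y)) refl [ a ]! [ b ]! [ c ]! (qbin₂ a b) (qbin₂ c (a ℕ.+ b)) ⟩
        K * (qbin₂ a b * qbin₂ c (a ℕ.+ b)) ∎)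
        where
        K = [ a ]! * [ b ]! * [ c ]!
        cancel : Cancellable K
        cancel = *-cancellable (*-cancellable ([]!-cancellable a) ([]!-cancellable b)) ([]!-cancellable c)

      qbin₂-product-pascal : ∀ t u w → let t+u = suc t ℕ.+ u in
        pow Q (suc t) * (qbin₂ (suc t) u * qbin₂ w (suc t+u)) + qbin₂ t (suc u) * qbin₂ (suc w) (suc t+u)
          ≈ qbin₂ (suc t ℕ.+ w) (suc u) * qbin₂ (suc t) (suc w)
      qbin₂-product-pascal t′ u w = cancel _ _ (trans lhs≈NF (sym rhs≈NF))
        where
        t = suc t′
        s = t ℕ.+ u
        X = pow Q t
        Y = pow Q (suc u)
        Z = pow Q (suc w)
        B = 1-Q^ suc (w ℕ.+ s)
        Ttu = qbin₂ t u
        Tws = qbin₂ w s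
        cancel : Cancellable ((1-Q^ suc u) * (1-Q^ suc w) * (1-Q^ suc s))
        cancel = *-cancellable (*-cancellable (1-Q^-cancellable u) (1-Q^-cancellable w)) (1-Q^-cancellable s)
        -- the two sides, multiplied by (1-Q^{u+1})(1-Q^{w+1})(1-Q^{s+1}), both reduce to this
        NF = (X * (1# + - Y) * (1# + - Z) + (1# + - X) * (1# + - (X * Y * Z))) * B * (Ttu * Tws)
        1-Q^-≈ : ∀ n {v} → pow Q n ≈ v → 1-Q^ n ≈ 1# + - v
        1-Q^-≈ _ e = +-congˡ (-‿cong e)
        Q^[1+s]≈XY : pow Q (suc s) ≈ X * Y
        Q^[1+s]≈XY = trans (reflexive (≡.cong (pow Q) (≡.sym (ℕ.+-suc t u)))) (pow-+ Q t (suc u))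
        Q^[2+w+s]≈XYZ : pow Q (suc (w ℕ.+ suc s)) ≈ X * Y * Z
        Q^[2+w+s]≈XYZ = trans (pow-+ Q (suc w) (suc s)) (trans (*-congˡ Q^[1+s]≈XY) (*-comm _ _))
        Q^[1+t+w]≈XZ : pow Q (suc (t ℕ.+ w)) ≈ X * Z
        Q^[1+t+w]≈XZ = trans (reflexive (≡.cong (pow Q) (≡.sym (ℕ.+-suc t w)))) (pow-+ Q t (suc w))
        lhs≈NF : (1-Q^ suc u) * (1-Q^ suc w) * (1-Q^ suc s) * (X * (Ttu * qbin₂ w (suc s)) + qbin₂ t′ (suc u) * qbin₂ (suc w) (suc s)) ≈ NF
        lhs≈NF = begin
          (1-Q^ suc u) * (1-Q^ suc w) * (1-Q^ suc s) * (X * (Ttu * qbin₂ w (suc s)) + qbin₂ t′ (suc u) * qbin₂ (suc w) (suc s))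
            ≈⟨ solve 8 (λ bu bw bs x ttu tw1 tt′ tsw1 → bu :* bw :* bs :* (x :* (ttu :* tw1) :+ tt′ :* tsw1) := x :* bu :* bw :* ttu :* (bs :* tw1) :+ (bu :* tt′) :* (bw :* tsw1) :* bs) refl (1-Q^ suc u) (1-Q^ suc w) (1-Q^ suc s) X Ttu (qbin₂ w (suc s)) (qbin₂ t′ (suc u)) (qbin₂ (suc w) (suc s)) ⟩
          X * (1-Q^ suc u) * (1-Q^ suc w) * Ttu * ((1-Q^ suc s) * qbin₂ w (suc s)) + ((1-Q^ suc u) * qbin₂ t′ (suc u)) * ((1-Q^ suc w) * qbin₂ (suc w) (suc s)) * (1-Q^ suc s)
            ≈⟨ +-cong (*-congˡ (qbin₂-absorbʳ w s)) (*-congʳ (*-cong (trans (qbin₂-absorbʳ t′ u) (sym (qbin₂-absorbˡ t′ u))) (qbin₂-absorbˡ w (suc s)))) ⟩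
          X * (1-Q^ suc u) * (1-Q^ suc w) * Ttu * (B * Tws) + ((1-Q^ t) * Ttu) * ((1-Q^ suc (w ℕ.+ suc s)) * qbin₂ w (suc s)) * (1-Q^ suc s)
            ≈⟨ +-congˡ (solve 5 (λ bt ttu b2 tw1 bs → (bt :* ttu) :* (b2 :* tw1) :* bs := bt :* ttu :* b2 :* (bs :* tw1)) refl (1-Q^ t) Ttu (1-Q^ suc (w ℕ.+ suc s)) (qbin₂ w (suc s)) (1-Q^ suc s)) ⟩
          X * (1-Q^ suc u) * (1-Q^ suc w) * Ttu * (B * Tws) + (1-Q^ t) * Ttu * (1-Q^ suc (w ℕ.+ suc s)) * ((1-Q^ suc s) * qbin₂ w (suc s))
            ≈⟨ +-congˡ (*-cong (*-congˡ (1-Q^-≈ (suc (w ℕ.+ suc s)) Q^[2+w+s]≈XYZ)) (qbin₂-absorbʳ w s)) ⟩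
          X * (1-Q^ suc u) * (1-Q^ suc w) * Ttu * (B * Tws) + (1-Q^ t) * Ttu * (1# + - (X * Y * Z)) * (B * Tws)
            ≈⟨ solve 7 (λ x y z b ttu tws xyz → x :* (con (+ 1) :- y) :* (con (+ 1) :- z) :* ttu :* (b :* tws) :+ (con (+ 1) :- x) :* ttu :* (con (+ 1) :- xyz) :* (b :* tws) := (x :* (con (+ 1) :- y) :* (con (+ 1) :- z) :+ (con (+ 1) :- x) :* (con (+ 1) :- xyz)) :* b :* (ttu :* tws)) refl X Y Z B Ttu Tws (X * Y * Z) ⟩
          NF ∎
        rhs≈NF : (1-Q^ suc u) * (1-Q^ suc w) * (1-Q^ suc s) * (qbin₂ (t ℕ.+ w) (suc u) * qbin₂ t (suc w)) ≈ NF
        rhs≈NF = begin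
          (1-Q^ suc u) * (1-Q^ suc w) * (1-Q^ suc s) * (qbin₂ (t ℕ.+ w) (suc u) * qbin₂ t (suc w))
            ≈⟨ solve 5 (λ bu bw bs x y → bu :* bw :* bs :* (x :* y) := bs :* (bu :* x) :* (bw :* y)) refl (1-Q^ suc u) (1-Q^ suc w) (1-Q^ suc s) (qbin₂ (t ℕ.+ w) (suc u)) (qbin₂ t (suc w)) ⟩
          (1-Q^ suc s) * ((1-Q^ suc u) * qbin₂ (t ℕ.+ w) (suc u)) * ((1-Q^ suc w) * qbin₂ t (suc w))
            ≈⟨ *-cong (*-congˡ (qbin₂-absorbʳ (t ℕ.+ w) u)) (qbin₂-absorbʳ t w) ⟩
          (1-Q^ suc s) * ((1-Q^ suc (t ℕ.+ w ℕ.+ u)) * qbin₂ (t ℕ.+ w) u) * ((1-Q^ suc (t ℕ.+ w)) * qbin₂ t w)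
            ≈⟨ solve 5 (λ bs b1 x b2 y → bs :* (b1 :* x) :* (b2 :* y) := bs :* b1 :* b2 :* (x :* y)) refl (1-Q^ suc s) (1-Q^ suc (t ℕ.+ w ℕ.+ u)) (qbin₂ (t ℕ.+ w) u) (1-Q^ suc (t ℕ.+ w)) (qbin₂ t w) ⟩
          (1-Q^ suc s) * (1-Q^ suc (t ℕ.+ w ℕ.+ u)) * (1-Q^ suc (t ℕ.+ w)) * (qbin₂ (t ℕ.+ w) u * qbin₂ t w)
            ≈⟨ *-cong (*-cong (*-cong (1-Q^-≈ (suc s) Q^[1+s]≈XY) (reflexive (≡.cong (λ n → 1-Q^ suc n) (a+c+b≡c+[a+b] t u w)))) (1-Q^-≈ (suc (t ℕ.+ w)) Q^[1+t+w]≈XZ)) (qbin₂-trinomial t u w) ⟩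
          (1# + - (X * Y)) * B * (1# + - (X * Z)) * (Ttu * Tws)
            ≈⟨ solve 6 (λ x y z b ttu tws → (con (+ 1) :- x :* y) :* b :* (con (+ 1) :- x :* z) :* (ttu :* tws) := (x :* (con (+ 1) :- y) :* (con (+ 1) :- z) :+ (con (+ 1) :- x) :* (con (+ 1) :- x :* y :* z)) :* b :* (ttu :* tws)) refl X Y Z B Ttu Tws ⟩
          NF ∎

      qbin-product-pascal : ∀ J t w →
        pow Q (suc t) * (qbin Q J (suc t) * qbin Q (suc (J ℕ.+ w)) w) + qbin Q J t * qbin Q (suc (suc (J ℕ.+ w))) (suc w)
          ≈ qbin Q (suc (suc t ℕ.+ w)) (suc t) * qbin Q (suc (J ℕ.+ w)) (suc t ℕ.+ w)
      qbin-product-pascal J t w with ℕ.<-cmp J t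
      ... | tri< J<t _ _ = begin
          pow Q (suc t) * (qbin Q J (suc t) * qbin Q (suc (J ℕ.+ w)) w) + qbin Q J t * qbin Q (suc (suc (J ℕ.+ w))) (suc w)
            ≈⟨ +-cong (*-congˡ (*-congʳ (qbin-< J (suc t) (ℕ.m<n⇒m<1+n J<t)))) (*-congʳ (qbin-< J t J<t)) ⟩
          pow Q (suc t) * (0# * qbin Q (suc (J ℕ.+ w)) w) + 0# * qbin Q (suc (suc (J ℕ.+ w))) (suc w)
            ≈⟨ solve 3 (λ x y z → x :* (con (+ 0) :* y) :+ con (+ 0) :* z := con (+ 0)) refl _ _ _ ⟩
          0# ≈⟨ zeroʳ _ ⟨
          qbin Q (suc (suc t ℕ.+ w)) (suc t) * 0#
            ≈⟨ *-congˡ (qbin-< (suc (J ℕ.+ w)) (suc t ℕ.+ w) (s≤s (ℕ.+-monoˡ-< w J<t))) ⟨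
          qbin Q (suc (suc t ℕ.+ w)) (suc t) * qbin Q (suc (J ℕ.+ w)) (suc t ℕ.+ w) ∎
      ... | tri≈ _ ≡.refl _ = begin
          pow Q (suc J) * (qbin Q J (suc J) * qbin Q (suc (J ℕ.+ w)) w) + qbin Q J J * qbin Q (suc (suc (J ℕ.+ w))) (suc w)
            ≈⟨ +-cong (*-congˡ (*-congʳ (qbin-< J (suc J) (ℕ.n<1+n J)))) (*-congʳ (qbin-diag J)) ⟩
          pow Q (suc J) * (0# * qbin Q (suc (J ℕ.+ w)) w) + 1# * qbin Q (suc (suc (J ℕ.+ w))) (suc w)
            ≈⟨ solve 3 (λ x y z → x :* (con (+ 0) :* y) :+ con (+ 1) :* z := z) refl _ _ _ ⟩
          qbin Q (suc (suc (J ℕ.+ w))) (suc w) ≈⟨ qbin-≡ (suc w) (2+[a+b]≡[1+b]+[1+a] J w) ⟩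
          qbin₂ (suc w) (suc J) ≈⟨ qbin₂-sym (suc w) (suc J) ⟩
          qbin₂ (suc J) (suc w) ≈⟨ qbin-≡ (suc J) (ℕ.+-suc (suc J) w) ⟩
          qbin Q (suc (suc J ℕ.+ w)) (suc J) ≈⟨ *-identityʳ _ ⟨
          qbin Q (suc (suc J ℕ.+ w)) (suc J) * 1# ≈⟨ *-congˡ (qbin-diag (suc (J ℕ.+ w))) ⟨
          qbin Q (suc (suc J ℕ.+ w)) (suc J) * qbin Q (suc (J ℕ.+ w)) (suc J ℕ.+ w) ∎
      ... | tri> _ _ t<J with ℕ.m≤n⇒∃[o]m+o≡n t<J
      ... | u , ≡.refl = begin
          pow Q (suc t) * (qbin Q J (suc t) * qbin Q (suc (J ℕ.+ w)) w) + qbin Q J t * qbin Q (suc (suc (J ℕ.+ w))) (suc w)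
            ≈⟨ +-cong (*-congˡ (*-congˡ (qbin-≡ w (1+[a+b]≡b+[1+a] J w))))
                      (*-cong (qbin-≡ t (≡.sym (ℕ.+-suc t u))) (qbin-≡ (suc w) (2+[a+b]≡[1+b]+[1+a] J w))) ⟩
          pow Q (suc t) * (qbin₂ (suc t) u * qbin₂ w (suc (suc t ℕ.+ u))) + qbin₂ t (suc u) * qbin₂ (suc w) (suc (suc t ℕ.+ u))
            ≈⟨ qbin₂-product-pascal t u w ⟩
          qbin₂ (suc t ℕ.+ w) (suc u) * qbin₂ (suc t) (suc w) ≈⟨ *-comm _ _ ⟩
          qbin₂ (suc t) (suc w) * qbin₂ (suc t ℕ.+ w) (suc u)
            ≈⟨ *-cong (qbin-≡ (suc t) (≡.sym (ℕ.+-suc (suc t) w))) (qbin-≡ (suc t ℕ.+ w) (1+[a+b+c]≡a+c+[1+b] (suc t) u w)) ⟨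
          qbin Q (suc (suc t ℕ.+ w)) (suc t) * qbin Q (suc (J ℕ.+ w)) (suc t ℕ.+ w) ∎

  module Telescoping (Q : Carrier) (1-Q^-cancellable : ∀ k → Cancellable (GaussianBinomial.1-Q^_ Q (suc k)))
                     (p : Carrier) (g : ℕ → Carrier) (g-suc : ∀ t → g (suc t) ≈ pow Q (suc t) * (p * g t)) where
    open GaussianBinomial Q
    open Cancellative 1-Q^-cancellable

    module _ (J M : ℕ) where
      s : ℕ → ℕ
      s k = J ℕ.+ M ∸ k

      α β γ : ℕ → Carrier
      α k = g k * qbin Q J k * qbin Q (suc (s k)) (M ∸ k)
      β k = g k * qbin Q M k * qbin Q (suc (s k)) M
      γ k = g k * qbin Q M k * qbin Q (s k) M

    α-step : ∀ J M t → suc t ≤ M → α J M (suc t) + p * α J M t ≈ β J M (suc t) + p * γ J M t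
    α-step J M t′ t≤M with ℕ.m≤n⇒∃[o]m+o≡n t≤M
    ... | w , ≡.refl = begin
      α J M t + p * α J M t′
        ≈⟨ +-cong (*-cong (*-congʳ (g-suc t′)) (qbin-≡ (M ∸ t) (≡.cong suc s-t≡))) (*-congˡ (*-congˡ (qbin-≡ (M ∸ t′) (≡.cong suc s-t′≡)))) ⟩
      pow Q t * (p * g t′) * qbin Q J t * qbin Q (suc (J ℕ.+ w)) (M ∸ t) + p * (g t′ * qbin Q J t′ * qbin Q (suc (suc (J ℕ.+ w))) (M ∸ t′))
        ≡⟨ ≡.cong₂ (λ x y → pow Q t * (p * g t′) * qbin Q J t * qbin Q (suc (J ℕ.+ w)) x + p * (g t′ * qbin Q J t′ * qbin Q (suc (suc (J ℕ.+ w))) y))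
                   (ℕ.m+n∸m≡n t w) M∸t′≡ ⟩
      pow Q t * (p * g t′) * qbin Q J t * qbin Q (suc (J ℕ.+ w)) w + p * (g t′ * qbin Q J t′ * qbin Q (suc (suc (J ℕ.+ w))) (suc w))
        ≈⟨ solve 7 (λ X P G a b c d → X :* (P :* G) :* a :* b :+ P :* (G :* c :* d) := (P :* G) :* (X :* (a :* b) :+ c :* d)) refl (pow Q t) p (g t′) (qbin Q J t) (qbin Q (suc (J ℕ.+ w)) w) (qbin Q J t′) (qbin Q (suc (suc (J ℕ.+ w))) (suc w)) ⟩
      (p * g t′) * (pow Q t * (qbin Q J t * qbin Q (suc (J ℕ.+ w)) w) + qbin Q J t′ * qbin Q (suc (suc (J ℕ.+ w))) (suc w))
        ≈⟨ *-congˡ (qbin-product-pascal J t′ w) ⟩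
      (p * g t′) * (qbin Q (suc M) t * B)
        ≈⟨ solve 6 (λ X P G a b B → (P :* G) :* ((a :+ X :* b) :* B) := X :* (P :* G) :* b :* B :+ P :* (G :* a :* B)) refl (pow Q t) p (g t′) (qbin Q M t′) (qbin Q M t) B ⟩
      pow Q t * (p * g t′) * qbin Q M t * B + p * (g t′ * qbin Q M t′ * B)
        ≈⟨ +-cong (*-cong (*-congʳ (g-suc t′)) (qbin-≡ M (≡.cong suc s-t≡))) (*-congˡ (*-congˡ (qbin-≡ M s-t′≡))) ⟨
      β J M t + p * γ J M t′ ∎
      where
      t = suc t′
      B = qbin Q (suc (J ℕ.+ w)) (t ℕ.+ w)
      M∸t′≡ : t ℕ.+ w ∸ t′ ≡ suc w
      M∸t′≡ = ≡.trans (≡.cong (_∸ t′) (≡.sym (ℕ.+-suc t′ w))) (ℕ.m+n∸m≡n t′ (suc w))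
      s-t≡ : J ℕ.+ (t ℕ.+ w) ∸ t ≡ J ℕ.+ w
      s-t≡ = ≡.trans (≡.cong (_∸ t) (a+[b+c]≡b+[a+c] J t w)) (ℕ.m+n∸m≡n t (J ℕ.+ w))
      s-t′≡ : J ℕ.+ (t ℕ.+ w) ∸ t′ ≡ suc (J ℕ.+ w)
      s-t′≡ = ≡.trans (≡.cong (_∸ t′) (J+[1+t+w]≡t+[1+J+w] J t′ w)) (ℕ.m+n∸m≡n t′ (suc (J ℕ.+ w)))

    telescope : ∀ J M (F G : ℕ → Carrier) → (∀ i → G (suc i) ≈ F (suc i) + p * F i) →
      Σ[ 0 ⋯ M ] (λ k → α J M k * G (suc (s J M k)))
        ≈ Σ[ 0 ⋯ M ] (λ k → β J M k * F (suc (s J M k))) + p * Σ[ 0 ⋯ M ] (λ k → γ J M k * F (s J M k))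
    telescope J M F G G≈ = begin
      Σ[ 0 ⋯ M ] (λ k → α J M k * G (suc (s J M k)))
        ≈⟨ Σ₀-cong M (λ k _ → trans (*-congˡ (G≈ (s J M k))) (solve 4 (λ a x P y → a :* (x :+ P :* y) := a :* x :+ P :* (a :* y)) refl (α J M k) _ p _)) ⟩
      Σ[ 0 ⋯ M ] (λ k → f k + h k) ≈⟨ Σ₀-+ M f h ⟨
      Σ[ 0 ⋯ M ] f + Σ[ 0 ⋯ M ] h ≈⟨ Σ₀-shift M f h f′ h′ refl hM≈ step≈ ⟩
      Σ[ 0 ⋯ M ] f′ + Σ[ 0 ⋯ M ] h′ ≈⟨ +-congˡ (Σ₀-*ˡ M p (λ k → γ J M k * F (s J M k))) ⟨
      Σ[ 0 ⋯ M ] (λ k → β J M k * F (suc (s J M k))) + p * Σ[ 0 ⋯ M ] (λ k → γ J M k * F (s J M k)) ∎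
      where
      f h f′ h′ : ℕ → Carrier
      f k = α J M k * F (suc (s J M k))
      h k = p * (α J M k * F (s J M k))
      f′ k = β J M k * F (suc (s J M k))
      h′ k = p * (γ J M k * F (s J M k))
      hM≈ : h M ≈ h′ M
      hM≈ = *-congˡ (*-congʳ (begin
        g M * qbin Q J M * qbin Q (suc (J ℕ.+ M ∸ M)) (M ∸ M) ≡⟨ ≡.cong (λ k → g M * qbin Q J M * qbin Q (suc (J ℕ.+ M ∸ M)) k) (ℕ.n∸n≡0 M) ⟩
        g M * qbin Q J M * 1# ≈⟨ solve 2 (λ x y → x :* y :* con (+ 1) := x :* con (+ 1) :* y) refl (g M) (qbin Q J M) ⟩
        g M * 1# * qbin Q J M ≈⟨ *-cong (*-congˡ (qbin-diag M)) (qbin-≡ M (ℕ.m+n∸n≡m J M)) ⟨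
        g M * qbin Q M M * qbin Q (J ℕ.+ M ∸ M) M ∎))
      step≈ : ∀ t → suc t ≤ M → f (suc t) + h t ≈ f′ (suc t) + h′ t
      step≈ t t<M = begin
        α J M (suc t) * F (suc (s J M (suc t))) + p * (α J M t * F (s J M t)) ≡⟨ ≡.cong (λ n → α J M (suc t) * X + p * (α J M t * F n)) s≡ ⟩
        α J M (suc t) * X + p * (α J M t * X)
          ≈⟨ solve 4 (λ a b P x → a :* x :+ P :* (b :* x) := (a :+ P :* b) :* x) refl (α J M (suc t)) (α J M t) p X ⟩
        (α J M (suc t) + p * α J M t) * X ≈⟨ *-congʳ (α-step J M t t<M) ⟩
        (β J M (suc t) + p * γ J M t) * X
          ≈⟨ solve 4 (λ a b P x → (a :+ P :* b) :* x := a :* x :+ P :* (b :* x)) refl (β J M (suc t)) (γ J M t) p X ⟩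
        β J M (suc t) * X + p * (γ J M t * X) ≡⟨ ≡.cong (λ n → β J M (suc t) * X + p * (γ J M t * F n)) s≡ ⟨
        f′ (suc t) + h′ t ∎
        where
        X = F (suc (s J M (suc t)))
        s≡ : s J M t ≡ suc (s J M (suc t))
        s≡ = ℕ.+-∸-assoc 1 (ℕ.≤-trans t<M (ℕ.m≤n+m M J))

  Σ-list : (List ℕ → Carrier) → List (List ℕ) → Carrier
  Σ-list h Ss = foldr (λ S acc → h S + acc) 0# Ss

  Σ-list-++ : ∀ h Ss Ts → Σ-list h (Ss ++ Ts) ≈ Σ-list h Ss + Σ-list h Ts
  Σ-list-++ h [] Ts = sym (+-identityˡ _)
  Σ-list-++ h (S ∷ Ss) Ts = trans (+-congˡ (Σ-list-++ h Ss Ts)) (sym (+-assoc _ _ _))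

  Σ-list-map : ∀ h f Ss → Σ-list h (map f Ss) ≡ Σ-list (λ S → h (f S)) Ss
  Σ-list-map h f [] = ≡.refl
  Σ-list-map h f (S ∷ Ss) = ≡.cong (_+_ (h (f S))) (Σ-list-map h f Ss)

  Σ-list-cong : ∀ {P : List ℕ → Set} h h′ Ss → (∀ S → P S → h S ≈ h′ S) → All P Ss → Σ-list h Ss ≈ Σ-list h′ Ss
  Σ-list-cong h h′ [] h≈h′ [] = refl
  Σ-list-cong h h′ (S ∷ Ss) h≈h′ (pS ∷ pSs) = +-cong (h≈h′ S pS) (Σ-list-cong h h′ Ss h≈h′ pSs)

  Σ-list-zero : ∀ Ss → Σ-list (λ _ → 0#) Ss ≈ 0#
  Σ-list-zero [] = refl
  Σ-list-zero (S ∷ Ss) = trans (+-identityˡ _) (Σ-list-zero Ss)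

  Σ-list-*ˡ : ∀ x h Ss → Σ-list (λ S → x * h S) Ss ≈ x * Σ-list h Ss
  Σ-list-*ˡ x h [] = sym (zeroʳ x)
  Σ-list-*ˡ x h (S ∷ Ss) = trans (+-congˡ (Σ-list-*ˡ x h Ss)) (sym (distribˡ _ _ _))

  Σ-list-subsets-suc : ∀ h k → Σ-list h (subsets (suc k)) ≈ Σ-list h (subsets k) + Σ-list (λ S → h (suc k ∷ S)) (subsets k)
  Σ-list-subsets-suc h k = trans (Σ-list-++ h (subsets k) _) (+-congˡ (reflexive (Σ-list-map h (suc k ∷_) (subsets k))))

  graded : (List ℕ → Carrier) → ℕ → ℕ → Carrier
  graded wt k m = Σ-list (λ S → if length S ≡ᵇ m then wt S else 0#) (subsets k)

  graded-zero : ∀ wt k → graded wt k 0 ≈ wt []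
  graded-zero wt zero = +-identityʳ _
  graded-zero wt (suc k) = begin
    graded wt (suc k) 0 ≈⟨ Σ-list-subsets-suc _ k ⟩
    graded wt k 0 + Σ-list (λ _ → 0#) (subsets k) ≈⟨ +-cong (graded-zero wt k) (Σ-list-zero (subsets k)) ⟩
    wt [] + 0# ≈⟨ +-identityʳ _ ⟩
    wt [] ∎

  graded-> : ∀ wt k m → k < m → graded wt k m ≈ 0#
  graded-> wt zero (suc m) _ = +-identityˡ 0#
  graded-> wt (suc k) (suc m) (s≤s k<m) = begin
    graded wt (suc k) (suc m) ≈⟨ Σ-list-subsets-suc _ k ⟩
    graded wt k (suc m) + graded (λ S → wt (suc k ∷ S)) k m ≈⟨ +-cong (graded-> wt k (suc m) (ℕ.m<n⇒m<1+n k<m)) (graded-> _ k m k<m) ⟩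
    0# + 0# ≈⟨ +-identityˡ 0# ⟩
    0# ∎

  module SubsetSums (q : Carrier) (a : ℕ → ℕ) (R′ N : ℕ)
    (Σa<a[r] : sumℕ 1 R′ a < a (suc R′)) (Σa≤N : sumℕ 1 (suc R′) a ≤ N) (1≤a[1] : 1 ≤ a 1) where
    r = suc R′
    p = pow q (a r)

    U V : ℕ → Carrier
    U = W q a r (a r)
    V = W q a r (N ℕ.+ a 1)

    H : ℕ → Carrier
    H = graded (λ S → pow q (σ a S)) R′

    U≈H : ∀ i → U i ≈ H i
    U≈H zero = sym (graded-zero _ R′)
    U≈H (suc n) = begin
      U (suc n) ≈⟨ Σ-list-subsets-suc summand R′ ⟩
      Σ-list summand (subsets R′) + Σ-list (λ S → summand (r ∷ S)) (subsets R′)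
        ≈⟨ +-cong (Σ-list-cong _ _ (subsets R′) without-r (σ-subsets-≤ a R′)) (Σ-list-cong _ _ (subsets R′) with-r (σ-subsets-≤ a R′)) ⟩
      H (suc n) + Σ-list (λ _ → 0#) (subsets R′) ≈⟨ +-congˡ (Σ-list-zero (subsets R′)) ⟩
      H (suc n) + 0# ≈⟨ +-identityʳ _ ⟩
      H (suc n) ∎
      where
      summand = λ S → if (length S ≡ᵇ suc n) ∧ (σ a S <ᵇ a r) then pow q (σ a S) else 0#
      without-r : ∀ S → σ a S ≤ sumℕ 1 R′ a → summand S ≈ (if length S ≡ᵇ suc n then pow q (σ a S) else 0#)
      without-r S σ≤ = reflexive (if-∧-true (length S ≡ᵇ suc n) _ _ (<⇒<ᵇ≡true (ℕ.≤-<-trans σ≤ Σa<a[r])))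
      with-r : ∀ S → σ a S ≤ sumℕ 1 R′ a → summand (r ∷ S) ≈ 0#
      with-r S _ = reflexive (if-∧-false (length (r ∷ S) ≡ᵇ suc n) _ _ (≮⇒<ᵇ≡false (λ lt → ℕ.<-irrefl ≡.refl (ℕ.<-≤-trans lt (ℕ.m≤m+n (a r) (σ a S))))))

    V≈H+pH : ∀ n → V (suc n) ≈ H (suc n) + p * H n
    V≈H+pH n = begin
      V (suc n) ≈⟨ Σ-list-subsets-suc summand R′ ⟩
      Σ-list summand (subsets R′) + Σ-list (λ S → summand (r ∷ S)) (subsets R′)
        ≈⟨ +-cong (Σ-list-cong _ _ (subsets R′) without-r (σ-subsets-≤ a R′)) (Σ-list-cong _ _ (subsets R′) with-r (σ-subsets-≤ a R′)) ⟩
      H (suc n) + Σ-list (λ S → p * (if length S ≡ᵇ n then pow q (σ a S) else 0#)) (subsets R′) ≈⟨ +-congˡ (Σ-list-*ˡ p _ (subsets R′)) ⟩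
      H (suc n) + p * H n ∎
      where
      summand = λ S → if (length S ≡ᵇ suc n) ∧ (σ a S <ᵇ N ℕ.+ a 1) then pow q (σ a S) else 0#
      below : ∀ x → x ≤ sumℕ 1 r a → x < N ℕ.+ a 1
      below x x≤ = ℕ.≤-<-trans (ℕ.≤-trans x≤ Σa≤N) (ℕ.m<m+n N 1≤a[1])
      without-r : ∀ S → σ a S ≤ sumℕ 1 R′ a → summand S ≈ (if length S ≡ᵇ suc n then pow q (σ a S) else 0#)
      without-r S σ≤ = reflexive (if-∧-true (length S ≡ᵇ suc n) _ _ (<⇒<ᵇ≡true (below _ (ℕ.≤-trans σ≤ (ℕ.m≤m+n _ _)))))
      with-r : ∀ S → σ a S ≤ sumℕ 1 R′ a → summand (r ∷ S) ≈ p * (if length S ≡ᵇ n then pow q (σ a S) else 0#)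
      with-r S σ≤ = trans (reflexive (if-∧-true (length S ≡ᵇ n) _ _ (<⇒<ᵇ≡true (below _ σ[r∷S]≤)))) (factor (length S ≡ᵇ n))
        where
        σ[r∷S]≤ : a r ℕ.+ σ a S ≤ sumℕ 1 r a
        σ[r∷S]≤ = ℕ.≤-trans (ℕ.+-monoʳ-≤ (a r) σ≤) (ℕ.≤-reflexive (ℕ.+-comm (a r) _))
        factor : ∀ b → (if b then pow q (a r ℕ.+ σ a S) else 0#) ≈ p * (if b then pow q (σ a S) else 0#)
        factor true = pow-+ q (a r) (σ a S)
        factor false = sym (zeroʳ p)

    V≈U+pU : ∀ i → V (suc i) ≈ U (suc i) + p * U i
    V≈U+pU i = trans (V≈H+pH i) (sym (+-cong (U≈H (suc i)) (*-congˡ (U≈H i))))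

    U-vanish : ∀ i → r ≤ i → U i ≈ 0#
    U-vanish i r≤i = trans (U≈H i) (graded-> _ R′ i r≤i)

  module Coefficients (q d : Carrier) (R′ N : ℕ) (a : ℕ → ℕ)
    (Σa<a[r] : sumℕ 1 R′ a < a (suc R′)) (Σa≤N : sumℕ 1 (suc R′) a ≤ N) (1≤a[1] : 1 ≤ a 1)
    (1-q^nN-cancellable : ∀ n → 1 ≤ n → Cancellable (1# + - pow q (n ℕ.* N))) where
    r = suc R′
    open Coeffs q d r N a
    open SubsetSums q a R′ N Σa<a[r] Σa≤N 1≤a[1] using (p; U; V; V≈U+pU; U-vanish)
    open GaussianBinomial QN using (qbin-≡; qbin-<; qbin-diag; 1-Q^_)

    1-Q^-cancellable : ∀ k → Cancellable (1-Q^ suc k)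
    1-Q^-cancellable k = Cancellable-resp (+-congˡ (-‿cong (sym (pow-* q N (suc k))))) (1-q^nN-cancellable (suc k) (s≤s z≤n))

    g : ℕ → Carrier
    g k = pow q (N ℕ.* tri k ℕ.+ k ℕ.* ar)

    g-suc : ∀ t → g (suc t) ≈ pow QN (suc t) * (p * g t)
    g-suc t = begin
      pow q (N ℕ.* tri (suc t) ℕ.+ suc t ℕ.* ar) ≡⟨ ≡.cong (λ n → pow q (N ℕ.* n ℕ.+ suc t ℕ.* ar)) (tri-suc t) ⟩
      pow q (N ℕ.* (tri t ℕ.+ suc t) ℕ.+ suc t ℕ.* ar) ≡⟨ ≡.cong (pow q) (g-exponent-suc N (tri t) t ar) ⟩
      pow q (suc t ℕ.* N ℕ.+ (ar ℕ.+ (N ℕ.* tri t ℕ.+ t ℕ.* ar))) ≈⟨ pow-+ q (suc t ℕ.* N) _ ⟩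
      pow q (suc t ℕ.* N) * pow q (ar ℕ.+ (N ℕ.* tri t ℕ.+ t ℕ.* ar)) ≈⟨ *-cong (sym (pow-* q N (suc t))) (pow-+ q ar _) ⟩
      pow QN (suc t) * (p * g t) ∎

    open Telescoping QN 1-Q^-cancellable p g g-suc

    cb fe fe′ : ℕ → ℕ → ℕ → Carrier
    cb J M k = α J M k * (pow d M * V (suc (s J M k)) + pow d (suc M) * V (suc (suc (s J M k))))
    fe J M μ = β J M μ * (pow d M * U (suc (s J M μ)) + pow d (suc M) * U (suc (suc (s J M μ))))
    fe′ J M μ = γ J M μ * (pow d M * U (s J M μ) + pow d (suc M) * U (suc (s J M μ)))

    cc*bb≈cb : ∀ J M k → k ≤ M → cc k (suc J) * bb (suc M ∸ k) (suc J) ≈ cb J M k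
    cc*bb≈cb J M k k≤M = begin
      cc k (suc J) * bb (suc M ∸ k) (suc J) ≡⟨ ≡.cong (λ m → cc k (suc J) * bb m (suc J)) (ℕ.+-∸-assoc 1 k≤M) ⟩
      cc k (suc J) * bb (suc e) (suc J) ≡⟨ ≡.cong (λ x → cc k (suc J) * b x) J+[1+e]≡ ⟩
      g k * qbin QN J k * pow d k * ((pow d e * V1 + (d * pow d e) * V2) * B)
        ≈⟨ solve 8 (λ G qJ dk de v1 v2 D b → G :* qJ :* dk :* ((de :* v1 :+ (D :* de) :* v2) :* b) := G :* qJ :* b :* ((dk :* de) :* v1 :+ D :* (dk :* de) :* v2)) refl (g k) (qbin QN J k) (pow d k) (pow d e) V1 V2 d B ⟩
      g k * qbin QN J k * B * ((pow d k * pow d e) * V1 + d * (pow d k * pow d e) * V2)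
        ≈⟨ *-congˡ (+-cong (*-congʳ dᵏdᵉ≈dᴹ) (*-congʳ (*-congˡ dᵏdᵉ≈dᴹ))) ⟩
      cb J M k ∎
      where
      e = M ∸ k
      V1 = V (suc (s J M k))
      V2 = V (suc (suc (s J M k)))
      B = qbin QN (suc (s J M k)) e
      b : ℕ → Carrier
      b x = (pow d e * V x + pow d (suc e) * V (suc x)) * qbin QN x e
      J+[1+e]≡ : J ℕ.+ suc e ≡ suc (s J M k)
      J+[1+e]≡ = ≡.trans (ℕ.+-suc J e) (≡.cong suc (≡.sym (ℕ.+-∸-assoc J k≤M)))
      dᵏdᵉ≈dᴹ : pow d k * pow d e ≈ pow d M
      dᵏdᵉ≈dᴹ = trans (sym (pow-+ d k e)) (reflexive (≡.cong (pow d) (ℕ.m+[n∸m]≡n k≤M)))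

    ee-shape : ∀ M x → ee (suc M) x ≡ (pow d M * U (x ℕ.+ M) + pow d (suc M) * U (suc (x ℕ.+ M))) * qbin QN (x ℕ.+ M) M
    ee-shape M x = ≡.cong (λ y → (pow d M * U (y ∸ 1) + pow d (suc M) * U y) * qbin QN (y ∸ 1) M) (ℕ.+-suc x M)

    ff*ee≈fe : ∀ J M μ → μ ≤ M → μ ≤ suc J → ff (suc M) μ * ee (suc M) (suc J ∸ μ) ≈ fe J M μ
    ff*ee≈fe J M μ μ≤M μ≤1+J = begin
      ff (suc M) μ * ee (suc M) (suc J ∸ μ) ≡⟨ ≡.cong (ff (suc M) μ *_) (≡.trans (ee-shape M (suc J ∸ μ)) (≡.cong E index≡)) ⟩
      g μ * qbin QN M μ * E (suc (s J M μ))
        ≈⟨ solve 5 (λ G qM X Y b → G :* qM :* ((X :+ Y) :* b) := G :* qM :* b :* (X :+ Y)) refl (g μ) (qbin QN M μ) _ _ _ ⟩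
      fe J M μ ∎
      where
      E : ℕ → Carrier
      E x = (pow d M * U x + pow d (suc M) * U (suc x)) * qbin QN x M
      index≡ : (suc J ∸ μ) ℕ.+ M ≡ suc (s J M μ)
      index≡ = ≡.trans (≡.sym (ℕ.+-∸-comm M μ≤1+J)) (ℕ.+-∸-assoc 1 (ℕ.≤-trans μ≤M (ℕ.m≤n+m M J)))

    ff*ee≈fe′ : ∀ J M μ → μ ≤ J → ff (suc M) μ * ee (suc M) (suc J ∸ μ ∸ 1) ≈ fe′ J M μ
    ff*ee≈fe′ J M μ μ≤J = begin
      ff (suc M) μ * ee (suc M) (suc J ∸ μ ∸ 1)
        ≡⟨ ≡.cong (ff (suc M) μ *_) (≡.trans (≡.cong (λ x → ee (suc M) (x ∸ 1)) (ℕ.+-∸-assoc 1 μ≤J)) (≡.trans (ee-shape M (J ∸ μ)) (≡.cong E (≡.sym (ℕ.+-∸-comm M μ≤J))))) ⟩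
      g μ * qbin QN M μ * E (s J M μ)
        ≈⟨ solve 5 (λ G qM X Y b → G :* qM :* ((X :+ Y) :* b) := G :* qM :* b :* (X :+ Y)) refl (g μ) (qbin QN M μ) _ _ _ ⟩
      fe′ J M μ ∎
      where
      E : ℕ → Carrier
      E x = (pow d M * U x + pow d (suc M) * U (suc x)) * qbin QN x M

    cb-vanish : ∀ J M k → J < k → cb J M k ≈ 0#
    cb-vanish J M k J<k = x≈0⇒x*y≈0 _ (x≈0⇒x*y≈0 _ (trans (*-congˡ (qbin-< J k J<k)) (zeroʳ _)))

    fe-vanish : ∀ J M μ → suc J < μ → μ ≤ M → fe J M μ ≈ 0#
    fe-vanish J M μ 1+J<μ μ≤M = x≈0⇒x*y≈0 _ (trans (*-congˡ (qbin-< _ M 1+s<M)) (zeroʳ _))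
      where
      1+s<M : suc (s J M μ) < M
      1+s<M = ≡.subst (_< M) (ℕ.+-∸-assoc 1 (ℕ.≤-trans μ≤M (ℕ.m≤n+m M J))) (J+M∸μ<M (suc J) M μ 1+J<μ μ≤M)

    fe′-vanish : ∀ J M μ → J < μ → μ ≤ M → fe′ J M μ ≈ 0#
    fe′-vanish J M μ J<μ μ≤M = x≈0⇒x*y≈0 _ (trans (*-congˡ (qbin-< _ M (J+M∸μ<M J M μ J<μ μ≤M))) (zeroʳ _))

    Σcb≈Σfe+pΣfe′ : ∀ J M → Σ[ 0 ⋯ M ] (cb J M) ≈ Σ[ 0 ⋯ M ] (fe J M) + p * Σ[ 0 ⋯ M ] (fe′ J M)
    Σcb≈Σfe+pΣfe′ J M = begin
      Σ[ 0 ⋯ M ] (cb J M)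
        ≈⟨ Σ₀-linear M (α J M) (λ k → V (suc (s J M k))) (λ k → V (suc (suc (s J M k)))) (pow d M) (pow d (suc M)) ⟩
      pow d M * Σ[ 0 ⋯ M ] (λ k → α J M k * V (suc (s J M k))) + pow d (suc M) * Σ[ 0 ⋯ M ] (λ k → α J M k * V (suc (suc (s J M k))))
        ≈⟨ +-cong (*-congˡ (telescope J M U V V≈U+pU)) (*-congˡ (telescope J M (λ i → U (suc i)) (λ i → V (suc i)) (λ i → V≈U+pU (suc i)))) ⟩
      pow d M * (βU₁ + p * γU₀) + pow d (suc M) * (βU₂ + p * γU₁)
        ≈⟨ solve 7 (λ x y u v w z P → x :* (u :+ P :* v) :+ y :* (w :+ P :* z) := (x :* u :+ y :* w) :+ P :* (x :* v :+ y :* z)) refl (pow d M) (pow d (suc M)) βU₁ γU₀ βU₂ γU₁ p ⟩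
      (pow d M * βU₁ + pow d (suc M) * βU₂) + p * (pow d M * γU₀ + pow d (suc M) * γU₁)
        ≈⟨ +-cong (Σ₀-linear M (β J M) (λ k → U (suc (s J M k))) (λ k → U (suc (suc (s J M k)))) (pow d M) (pow d (suc M)))
                  (*-congˡ (Σ₀-linear M (γ J M) (λ k → U (s J M k)) (λ k → U (suc (s J M k))) (pow d M) (pow d (suc M)))) ⟨
      Σ[ 0 ⋯ M ] (fe J M) + p * Σ[ 0 ⋯ M ] (fe′ J M) ∎
      where
      βU₁ = Σ[ 0 ⋯ M ] (λ k → β J M k * U (suc (s J M k)))
      βU₂ = Σ[ 0 ⋯ M ] (λ k → β J M k * U (suc (suc (s J M k))))
      γU₀ = Σ[ 0 ⋯ M ] (λ k → γ J M k * U (s J M k))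
      γU₁ = Σ[ 0 ⋯ M ] (λ k → γ J M k * U (suc (s J M k)))

    module _ (n M : ℕ) where
      x : ℕ → Carrier
      x j = pow q (j ℕ.* N ℕ.* (n ∸ suc M))

      inner₁ inner₂ inner₂′ : ℕ → Carrier
      inner₁ j = Σ[ 0 ⋯ (j ∸ 1) ⊓ M ] (λ k → cc k j * bb (suc M ∸ k) j * x j)
      inner₂ ν = Σ[ 0 ⋯ M ⊓ ν ] (λ μ → ff (suc M) μ * ee (suc M) (ν ∸ μ) * x ν)
      inner₂′ ν = Σ[ 0 ⋯ M ⊓ (ν ∸ 1) ] (λ μ → ff (suc M) μ * ee (suc M) (ν ∸ μ ∸ 1) * x ν)

    inner₁≈inner₂+p*inner₂′ : ∀ n M J → inner₁ n M (suc J) ≈ inner₂ n M (suc J) + p * inner₂′ n M (suc J)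
    inner₁≈inner₂+p*inner₂′ n M J = begin
      inner₁ n M (suc J)
        ≈⟨ Σ₀-⊓ J M _ (λ k → cb J M k * xJ) (λ k _ k≤M → *-congʳ (cc*bb≈cb J M k k≤M)) (λ k J<k _ → x≈0⇒x*y≈0 xJ (cb-vanish J M k J<k)) ⟩
      Σ[ 0 ⋯ M ] (λ k → cb J M k * xJ) ≈⟨ Σ₀-*ʳ M xJ (cb J M) ⟨
      Σ[ 0 ⋯ M ] (cb J M) * xJ ≈⟨ *-congʳ (Σcb≈Σfe+pΣfe′ J M) ⟩
      (Σ[ 0 ⋯ M ] (fe J M) + p * Σ[ 0 ⋯ M ] (fe′ J M)) * xJ
        ≈⟨ solve 4 (λ u v P X → (u :+ P :* v) :* X := u :* X :+ P :* (v :* X)) refl (Σ[ 0 ⋯ M ] (fe J M)) (Σ[ 0 ⋯ M ] (fe′ J M)) p xJ ⟩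
      Σ[ 0 ⋯ M ] (fe J M) * xJ + p * (Σ[ 0 ⋯ M ] (fe′ J M) * xJ)
        ≈⟨ +-cong (Σ₀-*ʳ M xJ (fe J M)) (*-congˡ (Σ₀-*ʳ M xJ (fe′ J M))) ⟩
      Σ[ 0 ⋯ M ] (λ μ → fe J M μ * xJ) + p * Σ[ 0 ⋯ M ] (λ μ → fe′ J M μ * xJ)
        ≈⟨ +-cong (Σ₀-⊓ (suc J) M _ _ (λ μ μ≤1+J μ≤M → *-congʳ (ff*ee≈fe J M μ μ≤M μ≤1+J)) (λ μ 1+J<μ μ≤M → x≈0⇒x*y≈0 xJ (fe-vanish J M μ 1+J<μ μ≤M)))
                  (*-congˡ (Σ₀-⊓ J M _ _ (λ μ μ≤J _ → *-congʳ (ff*ee≈fe′ J M μ μ≤J)) (λ μ J<μ μ≤M → x≈0⇒x*y≈0 xJ (fe′-vanish J M μ J<μ μ≤M)))) ⟨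
      Σ[ 0 ⋯ suc J ⊓ M ] F + p * Σ[ 0 ⋯ J ⊓ M ] F′
        ≡⟨ ≡.cong₂ (λ h h′ → Σ[ 0 ⋯ h ] F + p * Σ[ 0 ⋯ h′ ] F′) (ℕ.⊓-comm (suc J) M) (ℕ.⊓-comm J M) ⟩
      inner₂ n M (suc J) + p * inner₂′ n M (suc J) ∎
      where
      xJ = x n M (suc J)
      F = λ μ → ff (suc M) μ * ee (suc M) (suc J ∸ μ) * xJ
      F′ = λ μ → ff (suc M) μ * ee (suc M) (suc J ∸ μ ∸ 1) * xJ

    inner₂-zero : ∀ n M → inner₂ n M 0 ≈ pow d M * U M + pow d (suc M) * U (suc M)
    inner₂-zero n M = begin
      Σ[ 0 ⋯ M ⊓ 0 ] F ≡⟨ ≡.cong (λ h → Σ[ 0 ⋯ h ] F) (ℕ.⊓-zeroʳ M) ⟩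
      0# + pow q (N ℕ.* tri 0 ℕ.+ 0 ℕ.* ar) * qbin QN M 0 * (C * qbin QN M M) * 1#
        ≈⟨ +-congˡ (*-congʳ (*-cong (*-congʳ (reflexive (≡.cong (pow q) g-exponent-zero))) (*-congˡ (qbin-diag M)))) ⟩
      0# + 1# * 1# * (C * 1#) * 1# ≈⟨ solve 1 (λ c → con (+ 0) :+ con (+ 1) :* con (+ 1) :* (c :* con (+ 1)) :* con (+ 1) := c) refl C ⟩
      C ∎
      where
      C = pow d M * U M + pow d (suc M) * U (suc M)
      F = λ μ → ff (suc M) μ * ee (suc M) (0 ∸ μ) * x n M 0
      g-exponent-zero : N ℕ.* tri 0 ℕ.+ 0 ℕ.* ar ≡ 0
      g-exponent-zero = ≡.trans (ℕ.+-identityʳ _) (ℕ.*-zeroʳ N)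

    inner₂-r : ∀ n M → inner₂ n M r ≈ 0#
    inner₂-r n M = trans (Σ₀-cong (M ⊓ r) vanish) (Σ₀-zero (M ⊓ r))
      where
      vanish : ∀ μ → μ ≤ M ⊓ r → ff (suc M) μ * ee (suc M) (r ∸ μ) * x n M r ≈ 0#
      vanish μ μ≤ = x≈0⇒x*y≈0 _ (trans (*-congˡ (reflexive (ee-shape M (r ∸ μ)))) (trans (*-congˡ (x≈0⇒x*y≈0 _ U-terms≈0)) (zeroʳ _)))
        where
        y = (r ∸ μ) ℕ.+ M
        r≤y : r ≤ y
        r≤y = ℕ.≤-trans (ℕ.≤-reflexive (≡.sym (ℕ.m∸n+n≡m (ℕ.≤-trans μ≤ (ℕ.m⊓n≤n M r))))) (ℕ.+-monoʳ-≤ (r ∸ μ) (ℕ.≤-trans μ≤ (ℕ.m⊓n≤m M r)))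
        U-terms≈0 : pow d M * U y + pow d (suc M) * U (suc y) ≈ 0#
        U-terms≈0 = trans (+-cong (trans (*-congˡ (U-vanish y r≤y)) (zeroʳ _)) (trans (*-congˡ (U-vanish (suc y) (ℕ.m≤n⇒m≤1+n r≤y))) (zeroʳ _))) (+-identityˡ 0#)

    coef₁≈coef₂ : ∀ n M → coef₁ n (suc M) ≈ coef₂ n (suc M)
    coef₁≈coef₂ n M = begin
      C + Σ[ 1 ⋯ r ] (inner₁ n M) ≈⟨ +-cong (inner₂-zero n M) (Σ₁-cong r (λ { (suc J) _ _ → sym (inner₁≈inner₂+p*inner₂′ n M J) })) ⟨
      X 0 + Σ[ 1 ⋯ r ] (λ j → X j + p * Y j) ≈⟨ +-congˡ (Σ₁-+ r X (λ j → p * Y j)) ⟨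
      X 0 + (Σ[ 1 ⋯ r ] X + Σ[ 1 ⋯ r ] (λ j → p * Y j)) ≈⟨ +-congˡ (+-cong (+-congˡ (sym (inner₂-r n M))) (Σ₁-*ˡ r p Y)) ⟨
      X 0 + ((Σ[ 1 ⋯ R′ ] X + 0#) + p * Σ[ 1 ⋯ r ] Y) ≈⟨ +-congˡ (+-congʳ (+-identityʳ _)) ⟩
      X 0 + (Σ[ 1 ⋯ R′ ] X + p * Σ[ 1 ⋯ r ] Y) ≈⟨ +-assoc _ _ _ ⟨
      (X 0 + Σ[ 1 ⋯ R′ ] X) + p * Σ[ 1 ⋯ r ] Y ≈⟨ +-congʳ (Σ₀≈f0+Σ₁ R′ X) ⟨
      coef₂ n (suc M) ∎
      where
      C = pow d M * U M + pow d (suc M) * U (suc M)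
      X = inner₂ n M
      Y = inner₂′ n M

  module _ (q d : Carrier) (r N : ℕ) (a : ℕ → ℕ) where
    open Coeffs q d r N a using (rhs)

    rhs-cong : ∀ coef coef′ X X′ n → (∀ m → 1 ≤ m → coef n m ≈ coef′ n m) → (∀ k → k < n → X k ≈ X′ k) →
      rhs coef X n ≈ rhs coef′ X′ n
    rhs-cong coef coef′ X X′ n coef≈ X≈ = Σ₁-cong r term≈
      where
      term≈ : ∀ m → 1 ≤ m → m ≤ r →
        (if m ≤ᵇ n then coef n m * sign (suc m) * X (n ∸ m) else 0#) ≈ (if m ≤ᵇ n then coef′ n m * sign (suc m) * X′ (n ∸ m) else 0#)
      term≈ m 1≤m _ with m ≤ᵇ n in eq
      ... | false = refl
      ... | true = *-cong (*-congʳ (coef≈ m 1≤m)) (X≈ (n ∸ m) (ℕ.∸-monoʳ-< 1≤m (ℕ.≤ᵇ⇒≤ m n (≡.subst T (≡.sym eq) _))))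

    recurrence-unique : ∀ (lead : ℕ → Carrier) coef coef′ → (∀ n → 1 ≤ n → Cancellable (lead n)) →
      (∀ n m → 1 ≤ m → coef n m ≈ coef′ n m) → (A A′ : ℕ → Carrier) → A 0 ≈ A′ 0 →
      (∀ n → 1 ≤ n → lead n * A n ≈ rhs coef A n) → (∀ n → 1 ≤ n → lead n * A′ n ≈ rhs coef′ A′ n) →
      ∀ n → A n ≈ A′ n
    recurrence-unique lead coef coef′ cancellable coef≈ A A′ A0≈ recA recA′ = <-rec (λ n → A n ≈ A′ n) step
      where
      step : ∀ n → (∀ {k} → k < n → A k ≈ A′ k) → A n ≈ A′ n
      step zero _ = A0≈
      step (suc n) ih = cancellable (suc n) (s≤s z≤n) _ _
        (trans (recA (suc n) (s≤s z≤n)) (trans (rhs-cong coef coef′ A A′ (suc n) (coef≈ (suc n)) (λ _ → ih)) (sym (recA′ (suc n) (s≤s z≤n)))))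

lemma9 : ∀ {c ℓ} (R : CommutativeRing c ℓ) →
    let open CommutativeRing R in
    let open Setup R in
    (q d : Carrier) (r N : ℕ) (a : ℕ → ℕ) →
    1 ≤ r →
    (∀ k → 1 ≤ k → k ≤ r → sumℕ 1 (k ∸ 1) a < a k) →
    (∀ i j → 1 ≤ i → i ≤ r → 1 ≤ j → j ≤ r → i ≢ j → a i ≢ a j) →
    (∀ S T → S ∈ subsets r → T ∈ subsets r → S ≢ [] → T ≢ [] → S ≢ T → σ a S ≢ σ a T) →
    sumℕ 1 r a ≤ N →
    (∀ n → 1 ≤ n → Cancellable (1# + - pow q (n ℕ.* N))) →
    (A A′ : ℕ → Carrier) →
    A 0 ≈ 1# →
    (∀ n → 1 ≤ n → (1# + - pow q (n ℕ.* N)) * A n ≈ Coeffs.rhs q d r N a (Coeffs.coef₁ q d r N a) A n) →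
    A′ 0 ≈ 1# →
    (∀ n → 1 ≤ n → (1# + - pow q (n ℕ.* N)) * A′ n ≈ Coeffs.rhs q d r N a (Coeffs.coef₂ q d r N a) A′ n) →
    ∀ n → A n ≈ A′ n
lemma9 R q d r@(suc R′) N a (s≤s z≤n) superincreasing _ _ Σa≤N cancellable A A′ A0≈1 recA A′0≈1 recA′ =
  recurrence-unique R q d r N a _ _ _ cancellable coef₁≈coef₂ A A′ (trans A0≈1 (sym A′0≈1)) recA recA′
  where
  open CommutativeRing R using (sym; trans; _≈_)
  open Setup.Coeffs R q d r N a using (coef₁; coef₂)
  coef₁≈coef₂ : ∀ n m → 1 ≤ m → coef₁ n m ≈ coef₂ n m
  coef₁≈coef₂ n (suc M) _ = Coefficients.coef₁≈coef₂ R q d R′ N a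
    (superincreasing r (s≤s z≤n) ℕ.≤-refl) Σa≤N (superincreasing 1 (s≤s z≤n) (s≤s z≤n)) cancellable n M
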